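{- Let $p \ge 5$ be a prime and let $b,c,d$ be integers with $\gcd(b^2-3c,p)=1$ such that the cubic polynomial $x^3+bx^2+cx+d$ is irreducible modulo $p$. Let $c_0,c_1,c_2$ be any integers such that $x^p \equiv c_2x^2+c_1x+c_0 \bmod \langle x^3+bx^2+cx+d\rangle$ in $\mathbb{F}_p[x]$. Then $c_2$ is invertible modulo $p$, and setting $t \equiv (b^2-3c)(c_2)^{ -1} \pmod p$, we have \[ t^2 \equiv (18bcd-4b^3d+b^2c^2)-(4c^3+27d^2) \pmod p. \]
   Context: Here $x^p \bmod \langle f \rangle$ denotes the remainder of $x^p$ upon division by $f$ in $\mathbb{F}_p[x]$, i.e. reduction in the quotient ring $\mathbb{F}_p[x]/\langle f\rangle$; coefficients are taken modulo $p$. -}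

module Defs where

open import Data.Nat as ℕ using (ℕ; zero; suc)
open import Data.Integer using (ℤ; +_; _+_; _*_; _-_; 0ℤ; 1ℤ)
open import Data.Integer.Divisibility using (_∣_)
open import Data.List using (List; []; _∷_; replicate)
open import Data.Product using (Σ; _×_; ∃)
open import Relation.Nullary using (¬_)

-- Polynomials with integer coefficients, as coefficient lists,
-- lowest degree first:  a₀ ∷ a₁ ∷ … ∷ aₙ ∷ []  represents  a₀ + a₁x + … + aₙxⁿ.
Poly : Set
Poly = List ℤ

coeff : Poly → ℕ → ℤ
coeff []       _       = 0ℤ
coeff (a ∷ f)  zero    = a
coeff (a ∷ f)  (suc i) = coeff f i

infixl 6 _⊕_
infixl 7 _⊛_ _·_

_⊕_ : Poly → Poly → Poly
[]      ⊕ g       = g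
(a ∷ f) ⊕ []      = a ∷ f
(a ∷ f) ⊕ (b ∷ g) = (a + b) ∷ (f ⊕ g)

_·_ : ℤ → Poly → Poly
a · []      = []
a · (b ∷ g) = (a * b) ∷ (a · g)

_⊛_ : Poly → Poly → Poly
[]      ⊛ g = []
(a ∷ f) ⊛ g = (a · g) ⊕ (0ℤ ∷ (f ⊛ g))

X^ : ℕ → Poly
X^ n = Data.List._++_ (replicate n 0ℤ) (1ℤ ∷ [])

ModEq : ℕ → ℤ → ℤ → Set
ModEq p a b = (+ p) ∣ (a - b)

PolyEqMod : ℕ → Poly → Poly → Set
PolyEqMod p f g = ∀ i → ModEq p (coeff f i) (coeff g i)

NonConstant : ℕ → Poly → Set
NonConstant p f = ∃ λ i → (¬ ModEq p (coeff f (suc i)) 0ℤ)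

-- the image of f in 𝔽ₚ[x] is irreducible: non-constant and not a product
-- of two non-constant polynomials (the units of 𝔽ₚ[x] are the nonzero constants)
IrreducibleMod : ℕ → Poly → Set
IrreducibleMod p f =
  NonConstant p f ×
  ¬ (Σ Poly λ g → Σ Poly λ h →
       NonConstant p g × NonConstant p h × PolyEqMod p f (g ⊛ h))

PolyCongMod : ℕ → Poly → Poly → Poly → Set
PolyCongMod p m f g = Σ Poly λ q → PolyEqMod p f ((q ⊛ m) ⊕ g)

{-# OPTIONS --safe #-}
module Submission where

-- Let T = 𝔽ₚ[x]/⟨f⟩ with f = x³ + bx² + cx + d. As f has no factor of degree one, every nonzero
-- element of T is invertible, and the Frobenius map σ u = uᵖ is a ring endomorphism of T whose
-- fixed points are the constants, since xᵖ − x ≡ x(x − 1)⋯(x − (p − 1)) mod p. So the root x of f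
-- has the conjugates β = σ x ≠ x and r = − b − x − β, and σ permutes them as x ↦ β ↦ r ↦ x.
-- The hypothesis says g(x) = β for g(y) = c₀ + c₁ y + c₂ y²; applying σ gives g(β) = r and
-- g(r) = x. For a quadratic g cycling three points x, β, r one has the polynomial identity
-- c₂ δ + K = 0, where δ = (x − β)(β − r)(r − x) and K = (β − r)² − (x − β)(r − x), while the
-- Vieta formulas give K = b² − 3c and δ² = disc f. As b² − 3c ≢ 0, also c₂ ≢ 0, and then
-- t = K / c₂ = − δ satisfies t² = disc f.

open import Defs
open import Level using (Level; 0ℓ)
open import Function using (id; _∘_)
open import Data.Empty using (⊥; ⊥-elim)
open import Data.Product as Product using (Σ; _,_; proj₁; proj₂)
open import Data.Sum as Sum using (_⊎_; inj₁; inj₂; [_,_])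
open import Data.Maybe using (Maybe; just; nothing)
open import Data.List using (List; []; _∷_; drop)
open import Data.Fin using (Fin; fromℕ; inject₁)
import Data.Fin.Properties as Fin
open import Data.Nat as ℕ using (ℕ; zero; suc; _≤_; _<_; z≤n; s≤s)
import Data.Nat.Properties as ℕ
import Data.Nat.Divisibility as ℕ
import Data.Nat.GCD as ℕ
import Data.Nat.Tactic.RingSolver as ℕ-Solver
open import Data.Nat.Combinatorics using (nC1≡n; nCn≡1; nCk+nC[k+1]≡[n+1]C[k+1]) renaming (_C_ to _choose_)
open import Data.Nat.Combinatorics.Specification using (k>n⇒nCk≡0)
open import Data.Nat.Primality using (Prime; euclidsLemma; ¬prime[0]; ¬prime[1]; prime⇒nonTrivial)
open import Data.Integer as ℤ using (ℤ; +_; -[1+_]; 0ℤ; 1ℤ; ∣_∣)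
import Data.Integer.Properties as ℤ
import Data.Integer.Divisibility.Signed as ℤ
import Data.Integer.Tactic.RingSolver as ℤ-Solver
open import Data.Integer.GCD using (gcd)
open import Relation.Nullary using (¬_; Dec; yes; no)
open import Relation.Binary.PropositionalEquality as ≡ using (_≡_)
open import Relation.Binary.Structures using (IsEquivalence)
open import Algebra.Bundles using (CommutativeRing)
open import Algebra.Morphism.Structures using (module RingMorphisms)
import Algebra.Morphism.Construct.Identity as Identity
open import Algebra.Solver.Ring.AlmostCommutativeRing using (_-Raw-AlmostCommutative⟶_; fromCommutativeRing)
import Algebra.Solver.Ring
import Algebra.Properties.Semiring.Mult as SemiringMult

[1+k]*[1+n]C[1+k]≡[1+n]*nCk : ∀ n k → suc k ℕ.* (suc n choose suc k) ≡ suc n ℕ.* (n choose k)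
[1+k]*[1+n]C[1+k]≡[1+n]*nCk zero    zero    = ≡.refl
[1+k]*[1+n]C[1+k]≡[1+n]*nCk zero    (suc k) =
  ≡.trans (≡.cong (suc (suc k) ℕ.*_) (k>n⇒nCk≡0 {1} {suc (suc k)} (s≤s (s≤s z≤n)))) (ℕ.*-zeroʳ (suc (suc k)))
[1+k]*[1+n]C[1+k]≡[1+n]*nCk (suc n) zero    =
  ≡.trans (ℕ.*-identityˡ _) (≡.trans (nC1≡n (suc (suc n))) (≡.sym (ℕ.*-identityʳ _)))
[1+k]*[1+n]C[1+k]≡[1+n]*nCk (suc n) (suc k) = begin
  suc (suc k) ℕ.* (suc (suc n) choose suc (suc k))
    ≡⟨ ≡.cong (suc (suc k) ℕ.*_) (nCk+nC[k+1]≡[n+1]C[k+1] (suc n) (suc k)) ⟨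
  suc (suc k) ℕ.* (A ℕ.+ B)
    ≡⟨ regroup k A B ⟩
  suc k ℕ.* A ℕ.+ A ℕ.+ suc (suc k) ℕ.* B
    ≡⟨ ≡.cong₂ (λ u v → u ℕ.+ A ℕ.+ v) ([1+k]*[1+n]C[1+k]≡[1+n]*nCk n k)
                                       ([1+k]*[1+n]C[1+k]≡[1+n]*nCk n (suc k)) ⟩
  suc n ℕ.* (n choose k) ℕ.+ A ℕ.+ suc n ℕ.* (n choose suc k)
    ≡⟨ factor n (n choose k) A (n choose suc k) ⟩
  A ℕ.+ suc n ℕ.* (n choose k ℕ.+ n choose suc k)
    ≡⟨ ≡.cong (λ u → A ℕ.+ suc n ℕ.* u) (nCk+nC[k+1]≡[n+1]C[k+1] n k) ⟩
  A ℕ.+ suc n ℕ.* A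
    ∎
  where
  open ≡.≡-Reasoning
  A B : ℕ
  A = suc n choose suc k
  B = suc n choose suc (suc k)
  regroup : ∀ k A B → suc (suc k) ℕ.* (A ℕ.+ B) ≡ suc k ℕ.* A ℕ.+ A ℕ.+ suc (suc k) ℕ.* B
  regroup = ℕ-Solver.solve-∀
  factor : ∀ n x A y → suc n ℕ.* x ℕ.+ A ℕ.+ suc n ℕ.* y ≡ A ℕ.+ suc n ℕ.* (x ℕ.+ y)
  factor = ℕ-Solver.solve-∀

p∣pCk : ∀ {p k} → Prime p → 0 < k → k < p → p ℕ.∣ p choose k
p∣pCk {suc n} {suc k} p-prime _ k<p
  with euclidsLemma (suc k) (suc n choose suc k) p-prime
         (ℕ.divides (n choose k) (≡.trans ([1+k]*[1+n]C[1+k]≡[1+n]*nCk n k) (ℕ.*-comm (suc n) (n choose k))))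
... | inj₂ p∣pCk = p∣pCk
... | inj₁ p∣k   = ⊥-elim (ℕ.<⇒≱ k<p (ℕ.∣⇒≤ p∣k))

module PrimeCharacteristic {c ℓ : Level} (R : CommutativeRing c ℓ) where
  open CommutativeRing R hiding (zero)
  open SemiringMult semiring using (_×_; ×-homo-1; ×-assoc-*; ×-congʳ)

  open import Algebra.Properties.Semiring.Exp semiring using (_^_; ^-congˡ)
  open import Algebra.Properties.Monoid.Mult +-monoid using (×-assocˡ)
  open import Algebra.Properties.CommutativeSemiring.Binomial commutativeSemiring
    using (theorem; binomialTerm)
  open import Algebra.Properties.Monoid.Sum +-monoid using (sum; sum-cong-≋; sum-replicate-zero; sum-init-last)
  open import Relation.Binary.Reasoning.Setoid setoid

  module Frobenius {p : ℕ} (p-prime : Prime p) (char-p : p × 1# ≈ 0#) where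

    p×x≈0 : ∀ x → p × x ≈ 0#
    p×x≈0 x = begin
      p × x         ≈⟨ ×-congʳ p (*-identityˡ x) ⟨
      p × (1# * x)  ≈⟨ ×-assoc-* p 1# x ⟨
      (p × 1#) * x  ≈⟨ *-congʳ char-p ⟩
      0# * x        ≈⟨ zeroˡ x ⟩
      0#            ∎

    pCk×x≈0 : ∀ {k} x → 0 < k → k < p → (p choose k) × x ≈ 0#
    pCk×x≈0 {k} x 0<k k<p with p∣pCk p-prime 0<k k<p
    ... | ℕ.divides q pCk≡q*p = begin
      (p choose k) × x  ≡⟨ ≡.cong (_× x) pCk≡q*p ⟩
      (q ℕ.* p) × x     ≈⟨ ×-assocˡ x q p ⟨
      q × (p × x)       ≈⟨ ×-congʳ q (p×x≈0 x) ⟩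
      q × 0#            ≈⟨ q×0≈0 q ⟩
      0#                ∎
      where
      q×0≈0 : ∀ n → n × 0# ≈ 0#
      q×0≈0 zero    = refl
      q×0≈0 (suc n) = trans (+-identityˡ (n × 0#)) (q×0≈0 n)

    ^p-distrib-+ : ∀ x y → (x + y) ^ p ≈ x ^ p + y ^ p
    ^p-distrib-+ x y = dream p ≡.refl
      where
      dream : ∀ n → n ≡ p → (x + y) ^ n ≈ x ^ n + y ^ n
      dream zero    ≡.refl = ⊥-elim (¬prime[0] p-prime)
      dream (suc m) ≡.refl = begin
        (x + y) ^ suc m
          ≈⟨ theorem (suc m) x y ⟩
        t Fin.zero + sum (λ i → t (Fin.suc i))
          ≈⟨ +-congˡ (sum-init-last (λ i → t (Fin.suc i))) ⟩
        t Fin.zero + (sum (λ i → t (Fin.suc (inject₁ i))) + t (Fin.suc (fromℕ m)))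
          ≈⟨ +-cong first (+-cong (sum-zero middle) last) ⟩
        y ^ suc m + (0# + x ^ suc m)
          ≈⟨ trans (+-congˡ (+-identityˡ _)) (+-comm _ _) ⟩
        x ^ suc m + y ^ suc m
          ∎
        where
        t : Fin (suc (suc m)) → Carrier
        t = binomialTerm x y (suc m)
        sum-zero : ∀ {k} {f : Fin k → Carrier} → (∀ i → f i ≈ 0#) → sum f ≈ 0#
        sum-zero {k} f≈0 = trans (sum-cong-≋ f≈0) (sum-replicate-zero k)
        first : t Fin.zero ≈ y ^ suc m
        first = trans (×-homo-1 _) (*-identityˡ _)
        middle : ∀ i → t (Fin.suc (inject₁ i)) ≈ 0#
        middle i = pCk×x≈0 _ (s≤s z≤n) (s≤s (≡.subst (_< m) (≡.sym (Fin.toℕ-inject₁ i)) (Fin.toℕ<n i)))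
        last : t (Fin.suc (fromℕ m)) ≈ x ^ suc m
        last = begin
          t (Fin.suc (fromℕ m))
            ≡⟨ ≡.cong (λ j → (suc m choose suc j) × (x ^ suc j * y ^ (m ℕ.∸ j))) (Fin.toℕ-fromℕ m) ⟩
          (suc m choose suc m) × (x ^ suc m * y ^ (m ℕ.∸ m))
            ≡⟨ ≡.cong₂ (λ k j → k × (x ^ suc m * y ^ j)) (nCn≡1 (suc m)) (ℕ.n∸n≡0 m) ⟩
          1 × (x ^ suc m * 1#)
            ≈⟨ trans (×-homo-1 _) (*-identityʳ _) ⟩
          x ^ suc m  ∎

    0#^p≈0# : 0# ^ p ≈ 0#
    0#^p≈0# = 0#^n≈0# p ≡.refl
      where
      0#^n≈0# : ∀ n → n ≡ p → 0# ^ n ≈ 0#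
      0#^n≈0# zero    ≡.refl = ⊥-elim (¬prime[0] p-prime)
      0#^n≈0# (suc n) _      = zeroˡ _

    ^p-distrib-neg : ∀ x → (- x) ^ p ≈ - (x ^ p)
    ^p-distrib-neg x = begin
      (- x) ^ p                               ≈⟨ +-identityˡ _ ⟨
      0# + (- x) ^ p                          ≈⟨ +-congʳ (-‿inverseˡ (x ^ p)) ⟨
      (- (x ^ p) + x ^ p) + (- x) ^ p          ≈⟨ +-assoc _ _ _ ⟩
      - (x ^ p) + (x ^ p + (- x) ^ p)          ≈⟨ +-congˡ (^p-distrib-+ x (- x)) ⟨
      - (x ^ p) + (x + - x) ^ p                ≈⟨ +-congˡ (trans (^-congˡ p (-‿inverseʳ x)) 0#^p≈0#) ⟩
      - (x ^ p) + 0#                          ≈⟨ +-identityʳ _ ⟩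
      - (x ^ p)                               ∎

    [n×1]^p≈n×1 : ∀ n → (n × 1#) ^ p ≈ n × 1#
    [n×1]^p≈n×1 zero    = 0#^p≈0#
    [n×1]^p≈n×1 (suc n) = begin
      (1# + n × 1#) ^ p          ≈⟨ ^p-distrib-+ 1# (n × 1#) ⟩
      1# ^ p + (n × 1#) ^ p      ≈⟨ +-cong (1#^n≈1# p) ([n×1]^p≈n×1 n) ⟩
      1# + n × 1#                ∎
      where
      1#^n≈1# : ∀ n → 1# ^ n ≈ 1#
      1#^n≈1# zero    = refl
      1#^n≈1# (suc n) = trans (*-identityˡ _) (1#^n≈1# n)

module Modulo (p : ℕ) where
  open import Data.Integer using (_+_; _*_; _-_; -_)

  infix 4 _≡ₚ_
  record _≡ₚ_ (a b : ℤ) : Set where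
    constructor mod
    field divides : + p ℤ.∣ a - b

  ≡ₚ⇒ModEq : ∀ {a b} → a ≡ₚ b → ModEq p a b
  ≡ₚ⇒ModEq (mod p∣a-b) = ℤ.∣⇒∣ᵤ p∣a-b

  ModEq⇒≡ₚ : ∀ {a b} → ModEq p a b → a ≡ₚ b
  ModEq⇒≡ₚ p∣a-b = mod (ℤ.∣ᵤ⇒∣ p∣a-b)

  ≡ₚ-reflexive : ∀ {a b} → a ≡ b → a ≡ₚ b
  ≡ₚ-reflexive {a} ≡.refl = mod (ℤ.divides 0ℤ (ℤ.+-inverseʳ a))

  ≡ₚ-sym : ∀ {a b} → a ≡ₚ b → b ≡ₚ a
  ≡ₚ-sym {a} {b} (mod p∣a-b) = mod (≡.subst (+ p ℤ.∣_) (swap a b) (ℤ.∣m⇒∣-m p∣a-b))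
    where
    swap : ∀ a b → - (a - b) ≡ b - a
    swap = ℤ-Solver.solve-∀

  ≡ₚ-trans : ∀ {a b c} → a ≡ₚ b → b ≡ₚ c → a ≡ₚ c
  ≡ₚ-trans {a} {b} {c} (mod p∣a-b) (mod p∣b-c) =
    mod (≡.subst (+ p ℤ.∣_) (telescope a b c) (ℤ.∣m∣n⇒∣m+n p∣a-b p∣b-c))
    where
    telescope : ∀ a b c → (a - b) + (b - c) ≡ a - c
    telescope = ℤ-Solver.solve-∀

  +-cong : ∀ {a a′ b b′} → a ≡ₚ a′ → b ≡ₚ b′ → a + b ≡ₚ a′ + b′
  +-cong {a} {a′} {b} {b′} (mod p∣a) (mod p∣b) =
    mod (≡.subst (+ p ℤ.∣_) (split a a′ b b′) (ℤ.∣m∣n⇒∣m+n p∣a p∣b))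
    where
    split : ∀ a a′ b b′ → (a - a′) + (b - b′) ≡ (a + b) - (a′ + b′)
    split = ℤ-Solver.solve-∀

  *-cong : ∀ {a a′ b b′} → a ≡ₚ a′ → b ≡ₚ b′ → a * b ≡ₚ a′ * b′
  *-cong {a} {a′} {b} {b′} (mod p∣a) (mod p∣b) =
    mod (≡.subst (+ p ℤ.∣_) (split a a′ b b′) (ℤ.∣m∣n⇒∣m+n (ℤ.∣m⇒∣m*n b p∣a) (ℤ.∣n⇒∣m*n a′ p∣b)))
    where
    split : ∀ a a′ b b′ → (a - a′) * b + a′ * (b - b′) ≡ a * b - a′ * b′
    split = ℤ-Solver.solve-∀

  neg-cong : ∀ {a a′} → a ≡ₚ a′ → - a ≡ₚ - a′
  neg-cong {a} {a′} (mod p∣a) = mod (≡.subst (+ p ℤ.∣_) (split a a′) (ℤ.∣m⇒∣-m p∣a))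
    where
    split : ∀ a a′ → - (a - a′) ≡ - a - - a′
    split = ℤ-Solver.solve-∀

  ℤ/p : CommutativeRing 0ℓ 0ℓ
  ℤ/p = record
    { Carrier = ℤ ; _≈_ = _≡ₚ_ ; _+_ = _+_ ; _*_ = _*_ ; -_ = -_ ; 0# = 0ℤ ; 1# = 1ℤ
    ; isCommutativeRing = record
      { isRing = record
        { +-isAbelianGroup = record
          { isGroup = record
            { isMonoid = record
              { isSemigroup = record
                { isMagma = record
                  { isEquivalence = record { refl = ≡ₚ-reflexive ≡.refl ; sym = ≡ₚ-sym ; trans = ≡ₚ-trans }
                  ; ∙-cong = +-cong }
                ; assoc = λ a b c → ≡ₚ-reflexive (ℤ.+-assoc a b c) }
              ; identity = (λ a → ≡ₚ-reflexive (ℤ.+-identityˡ a)) , (λ a → ≡ₚ-reflexive (ℤ.+-identityʳ a)) }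
            ; inverse = (λ a → ≡ₚ-reflexive (ℤ.+-inverseˡ a)) , (λ a → ≡ₚ-reflexive (ℤ.+-inverseʳ a))
            ; ⁻¹-cong = neg-cong }
          ; comm = λ a b → ≡ₚ-reflexive (ℤ.+-comm a b) }
        ; *-cong = *-cong
        ; *-assoc = λ a b c → ≡ₚ-reflexive (ℤ.*-assoc a b c)
        ; *-identity = (λ a → ≡ₚ-reflexive (ℤ.*-identityˡ a)) , (λ a → ≡ₚ-reflexive (ℤ.*-identityʳ a))
        ; distrib = (λ a b c → ≡ₚ-reflexive (ℤ.*-distribˡ-+ a b c)) , (λ a b c → ≡ₚ-reflexive (ℤ.*-distribʳ-+ a b c)) }
      ; *-comm = λ a b → ≡ₚ-reflexive (ℤ.*-comm a b) } }

  open CommutativeRing ℤ/p public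
    using (setoid) renaming (refl to ≡ₚ-refl)
  open import Algebra.Properties.Semiring.Exp (CommutativeRing.semiring ℤ/p) public using (_^_)
  open SemiringMult (CommutativeRing.semiring ℤ/p) using (_×_)

  ≡ₚ0⇒p∣∣a∣ : ∀ {a} → a ≡ₚ 0ℤ → p ℕ.∣ ∣ a ∣
  ≡ₚ0⇒p∣∣a∣ {a} a≡0 = ≡.subst (λ x → p ℕ.∣ ∣ x ∣) (ℤ.+-identityʳ a) (≡ₚ⇒ModEq a≡0)

  p∣∣a∣⇒≡ₚ0 : ∀ {a} → p ℕ.∣ ∣ a ∣ → a ≡ₚ 0ℤ
  p∣∣a∣⇒≡ₚ0 {a} p∣a = ModEq⇒≡ₚ (≡.subst (λ x → p ℕ.∣ ∣ x ∣) (≡.sym (ℤ.+-identityʳ a)) p∣a)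

  p≡ₚ0 : + p ≡ₚ 0ℤ
  p≡ₚ0 = p∣∣a∣⇒≡ₚ0 ℕ.∣-refl

  x-y≡ₚ0⇒x≡ₚy : ∀ {x y} → x - y ≡ₚ 0ℤ → x ≡ₚ y
  x-y≡ₚ0⇒x≡ₚy {x} {y} (mod p∣) = mod (≡.subst (+ p ℤ.∣_) (ℤ.+-identityʳ (x - y)) p∣)

  x≡ₚy⇒x-y≡ₚ0 : ∀ {x y} → x ≡ₚ y → x - y ≡ₚ 0ℤ
  x≡ₚy⇒x-y≡ₚ0 {x} {y} (mod p∣) = mod (≡.subst (+ p ℤ.∣_) (≡.sym (ℤ.+-identityʳ (x - y))) p∣)

  n×1≡+n : ∀ n → n × 1ℤ ≡ + n
  n×1≡+n zero    = ≡.refl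
  n×1≡+n (suc n) = ≡.cong (λ x → 1ℤ + x) (n×1≡+n n)

  module _ (p-prime : Prime p) where

    1≢ₚ0 : ¬ 1ℤ ≡ₚ 0ℤ
    1≢ₚ0 1≡0 = ¬prime[1] (≡.subst Prime (ℕ.∣1⇒≡1 (≡ₚ0⇒p∣∣a∣ 1≡0)) p-prime)

    coprime⇒≢ₚ0 : ∀ {a} → gcd a (+ p) ≡ 1ℤ → ¬ a ≡ₚ 0ℤ
    coprime⇒≢ₚ0 gcd≡1 a≡0 =
      1≢ₚ0 (p∣∣a∣⇒≡ₚ0 (≡.subst (p ℕ.∣_) (≡.cong ∣_∣ gcd≡1) (ℕ.gcd-greatest (≡ₚ0⇒p∣∣a∣ a≡0) ℕ.∣-refl)))

    ≡ₚ0? : ∀ a → Dec (a ≡ₚ 0ℤ)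
    ≡ₚ0? a with p ℕ.∣? ∣ a ∣
    ... | yes p∣a = yes (p∣∣a∣⇒≡ₚ0 p∣a)
    ... | no  p∤a = no (λ a≡0 → p∤a (≡ₚ0⇒p∣∣a∣ a≡0))

    ≡ₚ0-euclid : ∀ a b → a * b ≡ₚ 0ℤ → a ≡ₚ 0ℤ ⊎ b ≡ₚ 0ℤ
    ≡ₚ0-euclid a b ab≡0
      with euclidsLemma ∣ a ∣ ∣ b ∣ p-prime (≡.subst (p ℕ.∣_) (ℤ.abs-* a b) (≡ₚ0⇒p∣∣a∣ ab≡0))
    ... | inj₁ p∣a = inj₁ (p∣∣a∣⇒≡ₚ0 p∣a)
    ... | inj₂ p∣b = inj₂ (p∣∣a∣⇒≡ₚ0 p∣b)

    characteristic : p × 1ℤ ≡ₚ 0ℤ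
    characteristic = ≡ₚ-trans (≡ₚ-reflexive (n×1≡+n p)) p≡ₚ0

    open PrimeCharacteristic.Frobenius ℤ/p p-prime characteristic using (^p-distrib-neg; [n×1]^p≈n×1)

    fermat : ∀ a → a ^ p ≡ₚ a
    fermat (+ n)    = ≡.subst (λ x → x ^ p ≡ₚ x) (n×1≡+n n) ([n×1]^p≈n×1 n)
    fermat -[1+ n ] = ≡ₚ-trans (^p-distrib-neg (+ suc n)) (neg-cong (fermat (+ suc n)))

    inverse : ∀ a → ¬ a ≡ₚ 0ℤ → Σ ℤ λ u → a * u ≡ₚ 1ℤ
    inverse a a≢0 = invert p ≡.refl
      where
      invert : ∀ n → n ≡ p → Σ ℤ λ u → a * u ≡ₚ 1ℤ
      invert 0 ≡.refl = ⊥-elim (¬prime[0] p-prime)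
      invert 1 ≡.refl = ⊥-elim (¬prime[1] p-prime)
      invert (suc (suc m)) ≡.refl =
        a ^ m , x-y≡ₚ0⇒x≡ₚy ([ ⊥-elim ∘ a≢0 , id ] (≡ₚ0-euclid a _ a*[a*a^m-1]≡0))
        where
        factor : ∀ a u → a * (a * u - 1ℤ) ≡ a * (a * u) - a
        factor = ℤ-Solver.solve-∀
        a*[a*a^m-1]≡0 : a * (a * a ^ m - 1ℤ) ≡ₚ 0ℤ
        a*[a*a^m-1]≡0 = ≡ₚ-trans (≡ₚ-reflexive (factor a (a ^ m)))
                          (≡ₚ-trans (+-cong (fermat a) ≡ₚ-refl) (≡ₚ-reflexive (ℤ.+-inverseʳ a)))

discriminantℤ : ℤ → ℤ → ℤ → ℤ
discriminantℤ b c d =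
  (+ 18 ℤ.* b ℤ.* c ℤ.* d ℤ.- + 4 ℤ.* b ℤ.* b ℤ.* b ℤ.* d ℤ.+ b ℤ.* b ℤ.* c ℤ.* c)
    ℤ.- (+ 4 ℤ.* c ℤ.* c ℤ.* c ℤ.+ + 27 ℤ.* d ℤ.* d)

module ℤ/p-Algebra {p : ℕ} {c ℓ : Level} (R : CommutativeRing c ℓ) (ι : ℤ → CommutativeRing.Carrier R)
  (ι-hom : RingMorphisms.IsRingHomomorphism (CommutativeRing.rawRing (Modulo.ℤ/p p)) (CommutativeRing.rawRing R) ι)
  where

  open Modulo p using (_≡ₚ_; ≡ₚ-sym)
  open CommutativeRing R

  open RingMorphisms.IsRingHomomorphism ι-hom public
    renaming (⟦⟧-cong to ι-cong; +-homo to ι-+; *-homo to ι-*; -‿homo to ι-neg; 0#-homo to ι-0; 1#-homo to ι-1)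
  open import Relation.Binary.Reasoning.Setoid setoid

  private
    coefficient≟ : ∀ a b → Maybe (ι a ≈ ι b)
    coefficient≟ a b with a ℤ.≟ b
    ... | yes ≡.refl = just refl
    ... | no _       = nothing

    ι-morphism : ℤ.+-*-rawRing -Raw-AlmostCommutative⟶ fromCommutativeRing R
    ι-morphism = record { ⟦_⟧ = ι ; +-homo = ι-+ ; *-homo = ι-* ; -‿homo = ι-neg ; 0-homo = ι-0 ; 1-homo = ι-1 }

  module RingSolver = Algebra.Solver.Ring ℤ.+-*-rawRing (fromCommutativeRing R) ι-morphism coefficient≟

  open RingSolver using (solve; _:=_; _:+_; _:*_; _:-_; :-_; con)
  open import Algebra.Properties.Semiring.Exp semiring public using (_^_; ^-congˡ)
  open SemiringMult semiring using (_×_)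

  eval : Carrier → Poly → Carrier
  eval x []      = 0#
  eval x (a ∷ f) = ι a + x * eval x f

  eval-⊕ : ∀ x f g → eval x (f ⊕ g) ≈ eval x f + eval x g
  eval-⊕ x []      g       = sym (+-identityˡ _)
  eval-⊕ x (a ∷ f) []      = sym (+-identityʳ _)
  eval-⊕ x (a ∷ f) (b ∷ g) = begin
    ι (a ℤ.+ b) + x * eval x (f ⊕ g)                ≈⟨ +-cong (ι-+ a b) (*-congˡ (eval-⊕ x f g)) ⟩
    (ι a + ι b) + x * (eval x f + eval x g)       ≈⟨ regroup (ι a) (ι b) x (eval x f) (eval x g) ⟩
    (ι a + x * eval x f) + (ι b + x * eval x g)   ∎
    where
    regroup : ∀ A B x F G → (A + B) + x * (F + G) ≈ (A + x * F) + (B + x * G)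
    regroup = solve 5 (λ A B x F G → (A :+ B) :+ x :* (F :+ G) := (A :+ x :* F) :+ (B :+ x :* G)) refl

  eval-· : ∀ x a g → eval x (a · g) ≈ ι a * eval x g
  eval-· x a []      = sym (zeroʳ _)
  eval-· x a (b ∷ g) = begin
    ι (a ℤ.* b) + x * eval x (a · g)           ≈⟨ +-cong (ι-* a b) (*-congˡ (eval-· x a g)) ⟩
    ι a * ι b + x * (ι a * eval x g)         ≈⟨ regroup (ι a) (ι b) x (eval x g) ⟩
    ι a * (ι b + x * eval x g)               ∎
    where
    regroup : ∀ A B x G → A * B + x * (A * G) ≈ A * (B + x * G)
    regroup = solve 4 (λ A B x G → A :* B :+ x :* (A :* G) := A :* (B :+ x :* G)) refl

  eval-⊛ : ∀ x f g → eval x (f ⊛ g) ≈ eval x f * eval x g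
  eval-⊛ x []      g = sym (zeroˡ _)
  eval-⊛ x (a ∷ f) g = begin
    eval x (a · g ⊕ (0ℤ ∷ f ⊛ g))                         ≈⟨ eval-⊕ x (a · g) (0ℤ ∷ f ⊛ g) ⟩
    eval x (a · g) + (ι 0ℤ + x * eval x (f ⊛ g))          ≈⟨ +-cong (eval-· x a g) (+-congˡ (*-congˡ (eval-⊛ x f g))) ⟩
    ι a * eval x g + (ι 0ℤ + x * (eval x f * eval x g))   ≈⟨ regroup (ι a) x (eval x f) (eval x g) ⟩
    (ι a + x * eval x f) * eval x g                       ∎
    where
    regroup : ∀ A x F G → A * G + (ι 0ℤ + x * (F * G)) ≈ (A + x * F) * G
    regroup = solve 4 (λ A x F G → A :* G :+ (con 0ℤ :+ x :* (F :* G)) := (A :+ x :* F) :* G) refl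

  eval-X^ : ∀ x n → eval x (X^ n) ≈ x ^ n
  eval-X^ x zero    = trans (+-cong ι-1 (zeroʳ x)) (+-identityʳ 1#)
  eval-X^ x (suc n) = trans (+-cong ι-0 (*-congˡ (eval-X^ x n))) (+-identityˡ _)

  eval-[a,b] : ∀ x a b → eval x (a ∷ b ∷ []) ≈ ι a + x * ι b
  eval-[a,b] x a b = +-congˡ (*-congˡ (trans (+-congˡ (zeroʳ x)) (+-identityʳ (ι b))))

  eval-≡ₚ0 : ∀ x f → (∀ i → coeff f i ≡ₚ 0ℤ) → eval x f ≈ 0#
  eval-≡ₚ0 x []      f≡0 = refl
  eval-≡ₚ0 x (a ∷ f) f≡0 = begin
    ι a + x * eval x f   ≈⟨ +-cong (trans (ι-cong (f≡0 0)) ι-0) (*-congˡ (eval-≡ₚ0 x f (λ i → f≡0 (suc i)))) ⟩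
    0# + x * 0#          ≈⟨ trans (+-identityˡ _) (zeroʳ x) ⟩
    0#                   ∎

  eval-cong : ∀ x f g → (∀ i → coeff f i ≡ₚ coeff g i) → eval x f ≈ eval x g
  eval-cong x []      []      f≡g = refl
  eval-cong x (a ∷ f) []      f≡g = eval-≡ₚ0 x (a ∷ f) f≡g
  eval-cong x []      (b ∷ g) f≡g = sym (eval-≡ₚ0 x (b ∷ g) (λ i → ≡ₚ-sym (f≡g i)))
  eval-cong x (a ∷ f) (b ∷ g) f≡g =
    +-cong (ι-cong (f≡g 0)) (*-congˡ (eval-cong x f g (λ i → f≡g (suc i))))

  module _ (p-prime : Prime p) where
    open Modulo p using (p≡ₚ0; fermat) renaming (_^_ to _^ℤ_)
    open import Algebra.Properties.CommutativeSemiring.Exp commutativeSemiring using (^-distrib-*)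

    n×1≈ι[n] : ∀ n → n × 1# ≈ ι (+ n)
    n×1≈ι[n] zero    = sym ι-0
    n×1≈ι[n] (suc n) = trans (+-cong (sym ι-1) (n×1≈ι[n] n)) (sym (ι-+ 1ℤ (+ n)))

    characteristic : p × 1# ≈ 0#
    characteristic = trans (n×1≈ι[n] p) (trans (ι-cong p≡ₚ0) ι-0)

    open PrimeCharacteristic.Frobenius R p-prime characteristic public using (^p-distrib-+; ^p-distrib-neg; 0#^p≈0#)

    ι-^ : ∀ a n → ι (a ^ℤ n) ≈ ι a ^ n
    ι-^ a zero    = ι-1
    ι-^ a (suc n) = trans (ι-* a _) (*-congˡ (ι-^ a n))

    ι-^p : ∀ a → ι a ^ p ≈ ι a
    ι-^p a = trans (sym (ι-^ a p)) (ι-cong (fermat p-prime a))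

    ^p-eval : ∀ x f → eval x f ^ p ≈ eval (x ^ p) f
    ^p-eval x []      = 0#^p≈0#
    ^p-eval x (a ∷ f) = begin
      (ι a + x * eval x f) ^ p               ≈⟨ ^p-distrib-+ _ _ ⟩
      ι a ^ p + (x * eval x f) ^ p           ≈⟨ +-cong (ι-^p a) (^-distrib-* x (eval x f) p) ⟩
      ι a + x ^ p * eval x f ^ p             ≈⟨ +-congˡ (*-congˡ (^p-eval x f)) ⟩
      ι a + x ^ p * eval (x ^ p) f           ∎

  discriminant : Carrier → Carrier → Carrier → Carrier
  discriminant B C D =
    (ι (+ 18) * B * C * D - ι (+ 4) * B * B * B * D + B * B * C * C) - (ι (+ 4) * C * C * C + ι (+ 27) * D * D)

  discriminant-cong : ∀ {B B′ C C′ D D′} → B ≈ B′ → C ≈ C′ → D ≈ D′ → discriminant B C D ≈ discriminant B′ C′ D′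
  discriminant-cong B≈ C≈ D≈ = +-cong
    (+-cong (+-cong (*-cong (*-cong (*-congˡ B≈) C≈) D≈) (-‿cong (*-cong (*-cong (*-cong (*-congˡ B≈) B≈) B≈) D≈)))
            (*-cong (*-cong (*-cong B≈ B≈) C≈) C≈))
    (-‿cong (+-cong (*-cong (*-cong (*-congˡ C≈) C≈) C≈) (*-cong (*-congˡ D≈) D≈)))

  discriminant-of-roots : ∀ x y z →
    ((x - y) * (y - z) * (z - x)) * ((x - y) * (y - z) * (z - x)) ≈
    discriminant (- (x + y + z)) (x * y + y * z + z * x) (- (x * y * z))
  discriminant-of-roots = solve 3 (λ x y z →
    ((x :- y) :* (y :- z) :* (z :- x)) :* ((x :- y) :* (y :- z) :* (z :- x)) :=
    (con (+ 18) :* e₁ x y z :* e₂ x y z :* e₃ x y z :- con (+ 4) :* e₁ x y z :* e₁ x y z :* e₁ x y z :* e₃ x y z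
      :+ e₁ x y z :* e₁ x y z :* e₂ x y z :* e₂ x y z)
    :- (con (+ 4) :* e₂ x y z :* e₂ x y z :* e₂ x y z :+ con (+ 27) :* e₃ x y z :* e₃ x y z)) refl
    where
    e₁ e₂ e₃ : ∀ {n} → RingSolver.Polynomial n → RingSolver.Polynomial n → RingSolver.Polynomial n → RingSolver.Polynomial n
    e₁ x y z = :- (x :+ y :+ z)
    e₂ x y z = x :* y :+ y :* z :+ z :* x
    e₃ x y z = :- (x :* y :* z)

  ι-discriminant : ∀ b c d → ι (discriminantℤ b c d) ≈ discriminant (ι b) (ι c) (ι d)
  ι-discriminant b c d = solve 0
    (con (discriminantℤ b c d) :=
     (con (+ 18) :* con b :* con c :* con d :- con (+ 4) :* con b :* con b :* con b :* con d
       :+ con b :* con b :* con c :* con c)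
     :- (con (+ 4) :* con c :* con c :* con c :+ con (+ 27) :* con d :* con d)) refl

  b²-3c-of-roots : ∀ x y z →
    (y - z) * (y - z) - (x - y) * (z - x) ≈
    - (x + y + z) * - (x + y + z) - ι (+ 3) * (x * y + y * z + z * x)
  b²-3c-of-roots = solve 3 (λ x y z →
    (y :- z) :* (y :- z) :- (x :- y) :* (z :- x) :=
    :- (x :+ y :+ z) :* :- (x :+ y :+ z) :- con (+ 3) :* (x :* y :+ y :* z :+ z :* x)) refl

  ι-[b²-3c] : ∀ b c → ι (b ℤ.* b ℤ.- + 3 ℤ.* c) ≈ ι b * ι b - ι (+ 3) * ι c
  ι-[b²-3c] b c = solve 0 (con (b ℤ.* b ℤ.- + 3 ℤ.* c) := con b :* con b :- con (+ 3) :* con c) refl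

module RootCounting {p : ℕ} (p-prime : Prime p) where
  open Modulo p
  open ℤ/p-Algebra ℤ/p id (Identity.isRingHomomorphism (CommutativeRing.rawRing ℤ/p) ≡ₚ-refl)
    using () renaming (eval to evalₚ; eval-⊕ to evalₚ-⊕; eval-· to evalₚ-·; eval-⊛ to evalₚ-⊛; eval-X^ to evalₚ-X^; eval-≡ₚ0 to evalₚ-≡ₚ0)
  open import Data.Integer using (_+_; _*_; _-_; -_)

  k-m≢ₚ0 : ∀ {k m} → k < m → m < p → ¬ + k - + m ≡ₚ 0ℤ
  k-m≢ₚ0 {k} {m} k<m m<p k-m≡0 = ℕ.<⇒≱ (ℕ.≤-<-trans (ℕ.m∸n≤m m k) m<p) (ℕ.∣⇒≤ {{m∸k≢0}} p∣m∸k)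
    where
    m∸k≢0 : ℕ.NonZero (m ℕ.∸ k)
    m∸k≢0 = ℕ.>-nonZero (ℕ.m<n⇒0<n∸m k<m)
    ∣k-m∣≡m∸k : ∣ + k - + m ∣ ≡ m ℕ.∸ k
    ∣k-m∣≡m∸k = ≡.trans (≡.cong ∣_∣ (ℤ.m-n≡m⊖n k m))
                (≡.trans (ℤ.∣m⊖n∣≡∣n⊖m∣ k m) (≡.cong ∣_∣ (ℤ.⊖-≥ (ℕ.<⇒≤ k<m))))
    p∣m∸k : p ℕ.∣ m ℕ.∸ k
    p∣m∸k = ≡.subst (p ℕ.∣_) ∣k-m∣≡m∸k (≡ₚ0⇒p∣∣a∣ k-m≡0)

  infixl 7 _÷[x-_]
  _÷[x-_] : Poly → ℤ → Poly
  []      ÷[x- a ] = []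
  (b ∷ h) ÷[x- a ] = evalₚ a h ∷ h ÷[x- a ]

  evalₚ-÷[x-] : ∀ h a y → evalₚ y h - evalₚ a h ≡ (y - a) * evalₚ y (h ÷[x- a ])
  evalₚ-÷[x-] []      a y = ≡.sym (ℤ.*-zeroʳ (y - a))
  evalₚ-÷[x-] (b ∷ h) a y = begin
    (b + y * evalₚ y h) - (b + a * evalₚ a h)            ≡⟨ split b y a (evalₚ y h) (evalₚ a h) ⟩
    y * (evalₚ y h - evalₚ a h) + (y - a) * evalₚ a h    ≡⟨ ≡.cong (λ z → y * z + (y - a) * evalₚ a h) (evalₚ-÷[x-] h a y) ⟩
    y * ((y - a) * Q) + (y - a) * evalₚ a h              ≡⟨ factor y a Q (evalₚ a h) ⟩
    (y - a) * (evalₚ a h + y * Q)                        ∎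
    where
    open ≡.≡-Reasoning
    Q = evalₚ y (h ÷[x- a ])
    split : ∀ b y a Y A → (b + y * Y) - (b + a * A) ≡ y * (Y - A) + (y - a) * A
    split = ℤ-Solver.solve-∀
    factor : ∀ y a Q A → y * ((y - a) * Q) + (y - a) * A ≡ (y - a) * (A + y * Q)
    factor = ℤ-Solver.solve-∀

  coeff-÷[x-] : ∀ h a i → coeff (h ÷[x- a ]) i ≡ evalₚ a (drop (suc i) h)
  coeff-÷[x-] []      a i       = ≡.refl
  coeff-÷[x-] (b ∷ h) a zero    = ≡.refl
  coeff-÷[x-] (b ∷ h) a (suc i) = coeff-÷[x-] h a i

  coeff-drop : ∀ n h i → coeff (drop n h) i ≡ coeff h (n ℕ.+ i)
  coeff-drop zero    h       i = ≡.refl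
  coeff-drop (suc n) []      i = ≡.refl
  coeff-drop (suc n) (b ∷ h) i = coeff-drop n h i

  private
    0-a*0≡0 : ∀ a → 0ℤ - a * 0ℤ ≡ 0ℤ
    0-a*0≡0 a = ≡.trans (ℤ.+-identityˡ (- (a * 0ℤ))) (≡.cong -_ (ℤ.*-zeroʳ a))

  coeff-zero-÷[x-] : ∀ h a → coeff h 0 ≡ evalₚ a h - a * coeff (h ÷[x- a ]) 0
  coeff-zero-÷[x-] []      a = ≡.sym (0-a*0≡0 a)
  coeff-zero-÷[x-] (b ∷ h) a = cancel b a (evalₚ a h)
    where
    cancel : ∀ b a A → b ≡ (b + a * A) - a * A
    cancel = ℤ-Solver.solve-∀

  coeff-suc-÷[x-] : ∀ h a i → coeff h (suc i) ≡ coeff (h ÷[x- a ]) i - a * coeff (h ÷[x- a ]) (suc i)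
  coeff-suc-÷[x-] []      a i       = coeff-zero-÷[x-] [] a
  coeff-suc-÷[x-] (b ∷ h) a zero    = coeff-zero-÷[x-] h a
  coeff-suc-÷[x-] (b ∷ h) a (suc i) = coeff-suc-÷[x-] h a i

  coeff-÷[x-]≡ₚ0 : ∀ m h a → (∀ i → suc m ≤ i → coeff h i ≡ₚ 0ℤ) → ∀ i → m ≤ i → coeff (h ÷[x- a ]) i ≡ₚ 0ℤ
  coeff-÷[x-]≡ₚ0 m h a high≡0 i m≤i = begin
    coeff (h ÷[x- a ]) i        ≡⟨ coeff-÷[x-] h a i ⟩
    evalₚ a (drop (suc i) h)    ≈⟨ evalₚ-≡ₚ0 a (drop (suc i) h) drop≡0 ⟩
    0ℤ                          ∎
    where
    open import Relation.Binary.Reasoning.Setoid setoid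
    drop≡0 : ∀ j → coeff (drop (suc i) h) j ≡ₚ 0ℤ
    drop≡0 j = begin
      coeff (drop (suc i) h) j  ≡⟨ coeff-drop (suc i) h j ⟩
      coeff h (suc i ℕ.+ j)     ≈⟨ high≡0 (suc i ℕ.+ j) (s≤s (ℕ.≤-trans m≤i (ℕ.m≤m+n i j))) ⟩
      0ℤ                        ∎

  evalₚ-÷[x-]≡ₚ0 : ∀ h a y → ¬ y - a ≡ₚ 0ℤ → evalₚ y h ≡ₚ 0ℤ → evalₚ a h ≡ₚ 0ℤ → evalₚ y (h ÷[x- a ]) ≡ₚ 0ℤ
  evalₚ-÷[x-]≡ₚ0 h a y y-a≢0 h[y]≡0 h[a]≡0 =
    [ ⊥-elim ∘ y-a≢0 , id ] (≡ₚ0-euclid p-prime (y - a) (evalₚ y (h ÷[x- a ])) (begin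
      (y - a) * evalₚ y (h ÷[x- a ])   ≡⟨ evalₚ-÷[x-] h a y ⟨
      evalₚ y h - evalₚ a h            ≈⟨ +-cong h[y]≡0 (neg-cong h[a]≡0) ⟩
      0ℤ                               ∎))
    where open import Relation.Binary.Reasoning.Setoid setoid

  ÷[x-]≡ₚ0⇒≡ₚ0 : ∀ h a → evalₚ a h ≡ₚ 0ℤ → (∀ i → coeff (h ÷[x- a ]) i ≡ₚ 0ℤ) → ∀ i → coeff h i ≡ₚ 0ℤ
  ÷[x-]≡ₚ0⇒≡ₚ0 h a h[a]≡0 Q≡0 zero    = begin
    coeff h 0                                          ≡⟨ coeff-zero-÷[x-] h a ⟩
    evalₚ a h - a * coeff (h ÷[x- a ]) 0               ≈⟨ +-cong h[a]≡0 (neg-cong (*-cong (≡ₚ-refl {a}) (Q≡0 0))) ⟩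
    0ℤ - a * 0ℤ                                        ≡⟨ 0-a*0≡0 a ⟩
    0ℤ                                                 ∎
    where open import Relation.Binary.Reasoning.Setoid setoid
  ÷[x-]≡ₚ0⇒≡ₚ0 h a h[a]≡0 Q≡0 (suc i) = begin
    coeff h (suc i)                                    ≡⟨ coeff-suc-÷[x-] h a i ⟩
    coeff (h ÷[x- a ]) i - a * coeff (h ÷[x- a ]) (suc i)
      ≈⟨ +-cong (Q≡0 i) (neg-cong (*-cong (≡ₚ-refl {a}) (Q≡0 (suc i)))) ⟩
    0ℤ - a * 0ℤ                                        ≡⟨ 0-a*0≡0 a ⟩
    0ℤ                                                 ∎
    where open import Relation.Binary.Reasoning.Setoid setoid

  vanishing⇒coeff≡ₚ0 : ∀ n → n ≤ p → ∀ h →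
    (∀ i → n ≤ i → coeff h i ≡ₚ 0ℤ) → (∀ k → k < n → evalₚ (+ k) h ≡ₚ 0ℤ) →
    ∀ i → coeff h i ≡ₚ 0ℤ
  vanishing⇒coeff≡ₚ0 zero    _   h high≡0 _     i = high≡0 i z≤n
  vanishing⇒coeff≡ₚ0 (suc m) m<p h high≡0 roots =
    ÷[x-]≡ₚ0⇒≡ₚ0 h (+ m) (roots m ℕ.≤-refl)
      (vanishing⇒coeff≡ₚ0 m (ℕ.<⇒≤ m<p) (h ÷[x- + m ]) (coeff-÷[x-]≡ₚ0 m h (+ m) high≡0)
        (λ k k<m → evalₚ-÷[x-]≡ₚ0 h (+ m) (+ k) (k-m≢ₚ0 k<m m<p) (roots k (ℕ.m<n⇒m<1+n k<m)) (roots m ℕ.≤-refl)))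

  coeff-⊕ : ∀ f g i → coeff (f ⊕ g) i ≡ coeff f i + coeff g i
  coeff-⊕ []      g       i       = ≡.sym (ℤ.+-identityˡ _)
  coeff-⊕ (a ∷ f) []      i       = ≡.sym (ℤ.+-identityʳ _)
  coeff-⊕ (a ∷ f) (b ∷ g) zero    = ≡.refl
  coeff-⊕ (a ∷ f) (b ∷ g) (suc i) = coeff-⊕ f g i

  coeff-· : ∀ a g i → coeff (a · g) i ≡ a * coeff g i
  coeff-· a []      i       = ≡.sym (ℤ.*-zeroʳ a)
  coeff-· a (b ∷ g) zero    = ≡.refl
  coeff-· a (b ∷ g) (suc i) = coeff-· a g i

  agreeing⇒coeff≡ₚ : ∀ n → n ≤ p → ∀ f g →
    (∀ i → n ≤ i → coeff f i ≡ₚ coeff g i) → (∀ k → k < n → evalₚ (+ k) f ≡ₚ evalₚ (+ k) g) →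
    ∀ i → coeff f i ≡ₚ coeff g i
  agreeing⇒coeff≡ₚ n n≤p f g high roots i =
    x-y≡ₚ0⇒x≡ₚy (≡ₚ-trans (≡ₚ-reflexive (coeff-f-g i)) (vanishing⇒coeff≡ₚ0 n n≤p h h-high h-roots i))
    where
    open import Relation.Binary.Reasoning.Setoid setoid
    h : Poly
    h = f ⊕ (- 1ℤ) · g
    coeff-f-g : ∀ i → coeff f i - coeff g i ≡ coeff h i
    coeff-f-g i = ≡.sym (≡.trans (coeff-⊕ f _ i) (≡.cong (λ z → coeff f i + z) (≡.trans (coeff-· (- 1ℤ) g i) (ℤ.-1*i≡-i _))))
    h-high : ∀ i → n ≤ i → coeff h i ≡ₚ 0ℤ
    h-high i n≤i = ≡ₚ-trans (≡ₚ-reflexive (≡.sym (coeff-f-g i))) (x≡ₚy⇒x-y≡ₚ0 (high i n≤i))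
    h-roots : ∀ k → k < n → evalₚ (+ k) h ≡ₚ 0ℤ
    h-roots k k<n = begin
      evalₚ (+ k) h                                      ≈⟨ evalₚ-⊕ (+ k) f _ ⟩
      evalₚ (+ k) f + evalₚ (+ k) ((- 1ℤ) · g)           ≈⟨ +-cong (≡ₚ-refl {evalₚ (+ k) f}) (evalₚ-· (+ k) (- 1ℤ) g) ⟩
      evalₚ (+ k) f + (- 1ℤ) * evalₚ (+ k) g             ≡⟨ ≡.cong (λ z → evalₚ (+ k) f + z) (ℤ.-1*i≡-i _) ⟩
      evalₚ (+ k) f - evalₚ (+ k) g                      ≈⟨ x≡ₚy⇒x-y≡ₚ0 (roots k k<n) ⟩
      0ℤ                                                 ∎

  fallingFactorial : ℕ → Poly
  fallingFactorial zero    = 1ℤ ∷ []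
  fallingFactorial (suc n) = (- + n ∷ 1ℤ ∷ []) ⊛ fallingFactorial n

  x^p-x : Poly
  x^p-x = X^ p ⊕ (0ℤ ∷ - 1ℤ ∷ [])

  private
    coeff-[x+a]⊛ : ∀ a f j → coeff ((a ∷ 1ℤ ∷ []) ⊛ f) (suc j) ≡ a * coeff f (suc j) + coeff f j
    coeff-[x+a]⊛ a f j = begin
      coeff ((a ∷ 1ℤ ∷ []) ⊛ f) (suc j)                    ≡⟨ coeff-⊕ (a · f) (0ℤ ∷ (1ℤ ∷ []) ⊛ f) (suc j) ⟩
      coeff (a · f) (suc j) + coeff ((1ℤ ∷ []) ⊛ f) j       ≡⟨ ≡.cong₂ _+_ (coeff-· a f (suc j)) (coeff-⊕ (1ℤ · f) (0ℤ ∷ []) j) ⟩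
      a * coeff f (suc j) + (coeff (1ℤ · f) j + coeff (0ℤ ∷ []) j)  ≡⟨ ≡.cong (λ z → a * coeff f (suc j) + z) (≡.trans (≡.cong₂ _+_ (coeff-· 1ℤ f j) (coeff-[0] j)) (≡.trans (ℤ.+-identityʳ _) (ℤ.*-identityˡ _))) ⟩
      a * coeff f (suc j) + coeff f j                        ∎
      where
      open ≡.≡-Reasoning
      coeff-[0] : ∀ j → coeff (0ℤ ∷ []) j ≡ 0ℤ
      coeff-[0] zero    = ≡.refl
      coeff-[0] (suc j) = ≡.refl

  coeff-fallingFactorial-> : ∀ n i → n < i → coeff (fallingFactorial n) i ≡ 0ℤ
  coeff-fallingFactorial-> zero    (suc i) _         = ≡.refl
  coeff-fallingFactorial-> (suc n) (suc i) (s≤s n<i) = begin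
    coeff (fallingFactorial (suc n)) (suc i)                  ≡⟨ coeff-[x+a]⊛ (- + n) (fallingFactorial n) i ⟩
    - + n * coeff (fallingFactorial n) (suc i) + coeff (fallingFactorial n) i
      ≡⟨ ≡.cong₂ (λ u v → - + n * u + v) (coeff-fallingFactorial-> n (suc i) (ℕ.m<n⇒m<1+n n<i)) (coeff-fallingFactorial-> n i n<i) ⟩
    - + n * 0ℤ + 0ℤ                                           ≡⟨ ≡.trans (ℤ.+-identityʳ _) (ℤ.*-zeroʳ (- + n)) ⟩
    0ℤ                                                        ∎
    where open ≡.≡-Reasoning

  coeff-fallingFactorial-≡ : ∀ n → coeff (fallingFactorial n) n ≡ 1ℤ
  coeff-fallingFactorial-≡ zero    = ≡.refl
  coeff-fallingFactorial-≡ (suc n) = begin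
    coeff (fallingFactorial (suc n)) (suc n)                  ≡⟨ coeff-[x+a]⊛ (- + n) (fallingFactorial n) n ⟩
    - + n * coeff (fallingFactorial n) (suc n) + coeff (fallingFactorial n) n
      ≡⟨ ≡.cong₂ (λ u v → - + n * u + v) (coeff-fallingFactorial-> n (suc n) ℕ.≤-refl) (coeff-fallingFactorial-≡ n) ⟩
    - + n * 0ℤ + 1ℤ                                           ≡⟨ ≡.cong (_+ 1ℤ) (ℤ.*-zeroʳ (- + n)) ⟩
    1ℤ                                                        ∎
    where open ≡.≡-Reasoning

  evalₚ-fallingFactorial : ∀ n k → k < n → evalₚ (+ k) (fallingFactorial n) ≡ₚ 0ℤ
  evalₚ-fallingFactorial (suc n) k k<1+n with k ℕ.≟ n
  ... | yes ≡.refl = begin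
    evalₚ (+ k) (fallingFactorial (suc k))                          ≈⟨ evalₚ-⊛ (+ k) (- + k ∷ 1ℤ ∷ []) (fallingFactorial k) ⟩
    evalₚ (+ k) (- + k ∷ 1ℤ ∷ []) * evalₚ (+ k) (fallingFactorial k) ≡⟨ ≡.cong (_* evalₚ (+ k) (fallingFactorial k)) (x-x≡0 (+ k)) ⟩
    0ℤ * evalₚ (+ k) (fallingFactorial k)                           ≡⟨⟩
    0ℤ                                                              ∎
    where
    open import Relation.Binary.Reasoning.Setoid setoid
    x-x≡0 : ∀ x → - x + x * (1ℤ + x * 0ℤ) ≡ 0ℤ
    x-x≡0 = ℤ-Solver.solve-∀
  ... | no k≢n = begin
    evalₚ (+ k) (fallingFactorial (suc n))                          ≈⟨ evalₚ-⊛ (+ k) (- + n ∷ 1ℤ ∷ []) (fallingFactorial n) ⟩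
    evalₚ (+ k) (- + n ∷ 1ℤ ∷ []) * evalₚ (+ k) (fallingFactorial n) ≈⟨ *-cong (≡ₚ-refl {evalₚ (+ k) (- + n ∷ 1ℤ ∷ [])}) (evalₚ-fallingFactorial n k (ℕ.≤∧≢⇒< (ℕ.≤-pred k<1+n) k≢n)) ⟩
    evalₚ (+ k) (- + n ∷ 1ℤ ∷ []) * 0ℤ                              ≡⟨ ℤ.*-zeroʳ (evalₚ (+ k) (- + n ∷ 1ℤ ∷ [])) ⟩
    0ℤ                                                              ∎
    where open import Relation.Binary.Reasoning.Setoid setoid

  coeff-X^-> : ∀ n i → n < i → coeff (X^ n) i ≡ 0ℤ
  coeff-X^-> zero    (suc i) _         = ≡.refl
  coeff-X^-> (suc n) (suc i) (s≤s n<i) = coeff-X^-> n i n<i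

  coeff-X^-≡ : ∀ n → coeff (X^ n) n ≡ 1ℤ
  coeff-X^-≡ zero    = ≡.refl
  coeff-X^-≡ (suc n) = coeff-X^-≡ n

  fallingFactorial≡ₚx^p-x : ∀ i → coeff (fallingFactorial p) i ≡ₚ coeff x^p-x i
  fallingFactorial≡ₚx^p-x = agreeing⇒coeff≡ₚ p ℕ.≤-refl (fallingFactorial p) x^p-x high roots
    where
    open import Relation.Binary.Reasoning.Setoid setoid
    1<p : 1 < p
    1<p = ℕ.nonTrivial⇒n>1 p {{prime⇒nonTrivial p-prime}}
    coeff-x^p-x : ∀ i → p ≤ i → coeff x^p-x i ≡ coeff (X^ p) i
    coeff-x^p-x i p≤i = ≡.trans (coeff-⊕ (X^ p) _ i) (≡.trans (≡.cong (λ z → coeff (X^ p) i + z) (coeff-linear i (ℕ.<-≤-trans 1<p p≤i))) (ℤ.+-identityʳ _))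
      where
      coeff-linear : ∀ i → 1 < i → coeff (0ℤ ∷ - 1ℤ ∷ []) i ≡ 0ℤ
      coeff-linear (suc zero)    (s≤s ())
      coeff-linear (suc (suc i)) _ = ≡.refl
    high : ∀ i → p ≤ i → coeff (fallingFactorial p) i ≡ₚ coeff x^p-x i
    high i p≤i with ℕ.m≤n⇒m<n∨m≡n p≤i
    ... | inj₁ p<i    = ≡ₚ-reflexive (≡.trans (coeff-fallingFactorial-> p i p<i) (≡.sym (≡.trans (coeff-x^p-x i p≤i) (coeff-X^-> p i p<i))))
    ... | inj₂ ≡.refl = ≡ₚ-reflexive (≡.trans (coeff-fallingFactorial-≡ p) (≡.sym (≡.trans (coeff-x^p-x p p≤i) (coeff-X^-≡ p))))
    roots : ∀ k → k < p → evalₚ (+ k) (fallingFactorial p) ≡ₚ evalₚ (+ k) x^p-x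
    roots k k<p = ≡ₚ-sym (begin
      evalₚ (+ k) x^p-x                                       ≈⟨ evalₚ-⊕ (+ k) (X^ p) (0ℤ ∷ - 1ℤ ∷ []) ⟩
      evalₚ (+ k) (X^ p) + evalₚ (+ k) (0ℤ ∷ - 1ℤ ∷ [])       ≈⟨ +-cong (evalₚ-X^ (+ k) p) (≡ₚ-refl {evalₚ (+ k) (0ℤ ∷ - 1ℤ ∷ [])}) ⟩
      (+ k) ^ p + evalₚ (+ k) (0ℤ ∷ - 1ℤ ∷ [])                  ≡⟨ ≡.cong (λ z → (+ k) ^ p + z) (linear (+ k)) ⟩
      (+ k) ^ p - + k                                           ≈⟨ x≡ₚy⇒x-y≡ₚ0 (fermat p-prime (+ k)) ⟩
      0ℤ                                                      ≈⟨ evalₚ-fallingFactorial p k k<p ⟨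
      evalₚ (+ k) (fallingFactorial p)                        ∎)
      where
      linear : ∀ x → 0ℤ + x * (- 1ℤ + x * 0ℤ) ≡ - x
      linear = ℤ-Solver.solve-∀

module IntegralDomain-over-ℤ/p {p : ℕ} (p-prime : Prime p) {c ℓ : Level} (R : CommutativeRing c ℓ)
  (ι : ℤ → CommutativeRing.Carrier R)
  (ι-hom : RingMorphisms.IsRingHomomorphism (CommutativeRing.rawRing (Modulo.ℤ/p p)) (CommutativeRing.rawRing R) ι)
  where

  open CommutativeRing R
  open ℤ/p-Algebra R ι ι-hom
  open RootCounting p-prime using (fallingFactorial; x^p-x; fallingFactorial≡ₚx^p-x)
  open import Relation.Binary.Reasoning.Setoid setoid
  open RingSolver using (solve; _:=_; _:+_; _:*_; _:-_; :-_; con)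

  module _ (1≉0 : ¬ 1# ≈ 0#) (no-zero-divisors : ∀ x y → x * y ≈ 0# → x ≈ 0# ⊎ y ≈ 0#) where

    ^-≈0 : ∀ n x → x ^ n ≈ 0# → x ≈ 0#
    ^-≈0 zero    x 1≈0  = ⊥-elim (1≉0 1≈0)
    ^-≈0 (suc n) x xxⁿ≈0 = [ id , ^-≈0 n x ] (no-zero-divisors x (x ^ n) xxⁿ≈0)

    root-of-fallingFactorial : ∀ n x → eval x (fallingFactorial n) ≈ 0# → Σ ℕ λ k → x ≈ ι (+ k)
    root-of-fallingFactorial zero    x 1≈0 = ⊥-elim (1≉0 (trans (sym (eval-X^ x 0)) 1≈0))
    root-of-fallingFactorial (suc n) x ≈0 = [ (λ x-n≈0 → n , x≈n x-n≈0) , root-of-fallingFactorial n x ]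
      (no-zero-divisors _ _ (trans (sym (eval-⊛ x (ℤ.- + n ∷ 1ℤ ∷ []) (fallingFactorial n))) ≈0))
      where
      regroup : ∀ x A → x ≈ (A + x * ι 1ℤ) - A
      regroup = solve 2 (λ x A → x := (A :+ x :* con 1ℤ) :- A) refl
      x≈n : eval x (ℤ.- + n ∷ 1ℤ ∷ []) ≈ 0# → x ≈ ι (+ n)
      x≈n x-n≈0 = begin
        x                                                ≈⟨ regroup x (ι (ℤ.- + n)) ⟩
        (ι (ℤ.- + n) + x * ι 1ℤ) - ι (ℤ.- + n)           ≈⟨ +-congʳ (trans (sym (eval-[a,b] x (ℤ.- + n) 1ℤ)) x-n≈0) ⟩
        0# - ι (ℤ.- + n)                                 ≈⟨ +-identityˡ _ ⟩
        - ι (ℤ.- + n)                                    ≈⟨ ι-neg (ℤ.- + n) ⟨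
        ι (ℤ.- (ℤ.- + n))                                ≡⟨ ≡.cong ι (ℤ.neg-involutive (+ n)) ⟩
        ι (+ n)                                          ∎

    fixed⇒scalar : ∀ x → x ^ p ≈ x → Σ ℕ λ k → x ≈ ι (+ k)
    fixed⇒scalar x x^p≈x = root-of-fallingFactorial p x (begin
      eval x (fallingFactorial p)                      ≈⟨ eval-cong x (fallingFactorial p) x^p-x fallingFactorial≡ₚx^p-x ⟩
      eval x (X^ p ⊕ (0ℤ ∷ ℤ.- 1ℤ ∷ []))               ≈⟨ eval-⊕ x (X^ p) (0ℤ ∷ ℤ.- 1ℤ ∷ []) ⟩
      eval x (X^ p) + eval x (0ℤ ∷ ℤ.- 1ℤ ∷ [])        ≈⟨ +-cong (trans (eval-X^ x p) x^p≈x) (eval-[a,b] x 0ℤ (ℤ.- 1ℤ)) ⟩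
      x + (ι 0ℤ + x * ι (ℤ.- 1ℤ))                      ≈⟨ cancel x ⟩
      ι 0ℤ                                             ≈⟨ ι-0 ⟩
      0#                                               ∎)
      where
      cancel : ∀ x → x + (ι 0ℤ + x * ι (ℤ.- 1ℤ)) ≈ ι 0ℤ
      cancel = solve 1 (λ x → x :+ (con 0ℤ :+ x :* con (ℤ.- 1ℤ)) := con 0ℤ) refl

    module CubicFrobeniusOrbit (b c d : ℤ)
      (no-scalar-root : ∀ a → ¬ ι (d ℤ.+ a ℤ.* (c ℤ.+ a ℤ.* (b ℤ.+ a ℤ.* 1ℤ))) ≈ 0#)
      (X : Carrier) (X-root : eval X (d ∷ c ∷ b ∷ 1ℤ ∷ []) ≈ 0#)
      (c₀ c₁ c₂ : ℤ) (g[X]≈X^p : eval X (c₀ ∷ c₁ ∷ c₂ ∷ []) ≈ X ^ p)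
      where

      open import Algebra.Properties.Group +-group using (x∙y⁻¹≈ε⇒x≈y; x≈y⇒x∙y⁻¹≈ε)

      private
        cancel : ∀ {x y} → x + y ≈ 0# → y ≈ 0# → x ≈ 0#
        cancel {x} x+y≈0 y≈0 = trans (sym (+-identityʳ x)) (trans (+-congˡ (sym y≈0)) x+y≈0)

      B C D : Carrier
      B = ι b
      C = ι c
      D = ι d

      F : Carrier → Carrier
      F y = D + y * (C + y * (B + y * ι 1ℤ))

      eval-cubic : ∀ y → eval y (d ∷ c ∷ b ∷ 1ℤ ∷ []) ≈ F y
      eval-cubic y = +-congˡ (*-congˡ (+-congˡ (*-congˡ (eval-[a,b] y b 1ℤ))))

      β γ r : Carrier
      β = X ^ p
      γ = β ^ p
      r = - (B + X + β)

      Q : Carrier → Carrier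
      Q y = y * y + (B + X) * y + (C + B * X + X * X)

      F-factor : ∀ y → F y ≈ (y - X) * Q y + F X
      F-factor y = identity y X B C D
        where
        identity : ∀ y X B C D → D + y * (C + y * (B + y * ι 1ℤ)) ≈
          (y - X) * (y * y + (B + X) * y + (C + B * X + X * X)) + (D + X * (C + X * (B + X * ι 1ℤ)))
        identity = solve 5 (λ y X B C D → D :+ y :* (C :+ y :* (B :+ y :* con 1ℤ)) :=
          (y :- X) :* (y :* y :+ (B :+ X) :* y :+ (C :+ B :* X :+ X :* X)) :+ (D :+ X :* (C :+ X :* (B :+ X :* con 1ℤ)))) refl

      Q-factor : ∀ y → Q y ≈ (y - β) * (y - r) + Q β
      Q-factor y = identity y X β B C
        where
        identity : ∀ y X β B C → y * y + (B + X) * y + (C + B * X + X * X) ≈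
          (y - β) * (y - - (B + X + β)) + (β * β + (B + X) * β + (C + B * X + X * X))
        identity = solve 5 (λ y X β B C → y :* y :+ (B :+ X) :* y :+ (C :+ B :* X :+ X :* X) :=
          (y :- β) :* (y :- :- (B :+ X :+ β)) :+ (β :* β :+ (B :+ X) :* β :+ (C :+ B :* X :+ X :* X))) refl

      FX≈0 : F X ≈ 0#
      FX≈0 = trans (sym (eval-cubic X)) X-root

      F^p : ∀ y → F y ≈ 0# → F (y ^ p) ≈ 0#
      F^p y Fy≈0 = begin
        F (y ^ p)                               ≈⟨ eval-cubic (y ^ p) ⟨
        eval (y ^ p) (d ∷ c ∷ b ∷ 1ℤ ∷ [])       ≈⟨ ^p-eval p-prime y (d ∷ c ∷ b ∷ 1ℤ ∷ []) ⟨
        eval y (d ∷ c ∷ b ∷ 1ℤ ∷ []) ^ p         ≈⟨ ^-congˡ p (trans (eval-cubic y) Fy≈0) ⟩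
        0# ^ p                                  ≈⟨ 0#^p≈0# p-prime ⟩
        0#                                      ∎

      root-not-fixed : ∀ y → F y ≈ 0# → ¬ y ^ p ≈ y
      root-not-fixed y Fy≈0 y^p≈y = scalar-root (fixed⇒scalar y y^p≈y)
        where
        value : ℤ → ℤ
        value a = d ℤ.+ a ℤ.* (c ℤ.+ a ℤ.* (b ℤ.+ a ℤ.* 1ℤ))
        ι-value : ∀ a → ι (value a) ≈ F (ι a)
        ι-value a = solve 0 (con (value a) := con d :+ con a :* (con c :+ con a :* (con b :+ con a :* con 1ℤ))) refl
        F-cong : ∀ {y z} → y ≈ z → F y ≈ F z
        F-cong y≈z = +-congˡ (*-cong y≈z (+-congˡ (*-cong y≈z (+-congˡ (*-congʳ y≈z)))))
        scalar-root : Σ ℕ (λ k → y ≈ ι (+ k)) → ⊥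
        scalar-root (k , y≈k) = no-scalar-root (+ k) (begin
          ι (value (+ k))     ≈⟨ ι-value (+ k) ⟩
          F (ι (+ k))         ≈⟨ F-cong (sym y≈k) ⟩
          F y                 ≈⟨ Fy≈0 ⟩
          0#                  ∎)

      root⇒X⊎Q≈0 : ∀ y → F y ≈ 0# → y ≈ X ⊎ Q y ≈ 0#
      root⇒X⊎Q≈0 y Fy≈0 = Sum.map₁ (x∙y⁻¹≈ε⇒x≈y y X) (no-zero-divisors (y - X) (Q y) (cancel (trans (sym (F-factor y)) Fy≈0) FX≈0))

      β-root : F β ≈ 0#
      β-root = F^p X FX≈0

      γ-root : F γ ≈ 0#
      γ-root = F^p β β-root

      β≉X : ¬ β ≈ X
      β≉X = root-not-fixed X FX≈0

      Qβ≈0 : Q β ≈ 0#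
      Qβ≈0 = Q-root (root⇒X⊎Q≈0 β β-root)
        where
        Q-root : β ≈ X ⊎ Q β ≈ 0# → Q β ≈ 0#
        Q-root (inj₁ β≈X)  = ⊥-elim (β≉X β≈X)
        Q-root (inj₂ Qβ≈0) = Qβ≈0

      Q≈0⇒β⊎r : ∀ y → Q y ≈ 0# → y ≈ β ⊎ y ≈ r
      Q≈0⇒β⊎r y Qy≈0 = Sum.map (x∙y⁻¹≈ε⇒x≈y y β) (x∙y⁻¹≈ε⇒x≈y y r)
        (no-zero-divisors (y - β) (y - r) (cancel (trans (sym (Q-factor y)) Qy≈0) Qβ≈0))

      r-root : F r ≈ 0#
      r-root = begin
        F r                       ≈⟨ F-factor r ⟩
        (r - X) * Q r + F X       ≈⟨ +-cong (*-congˡ (trans (Q-factor r) (+-cong (*-congˡ (-‿inverseʳ r)) Qβ≈0))) FX≈0 ⟩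
        (r - X) * ((r - β) * 0# + 0#) + 0#   ≈⟨ trans (+-identityʳ _) (trans (*-congˡ (trans (+-identityʳ _) (zeroʳ _))) (zeroʳ _)) ⟩
        0#                        ∎

      r^p : r ^ p ≈ - (B + β + γ)
      r^p = begin
        (- (B + X + β)) ^ p              ≈⟨ ^p-distrib-neg p-prime _ ⟩
        - ((B + X + β) ^ p)              ≈⟨ -‿cong (trans (^p-distrib-+ p-prime _ _) (+-congʳ (trans (^p-distrib-+ p-prime _ _) (+-congʳ (ι-^p p-prime b))))) ⟩
        - (B + β + γ)                    ∎

      γ≉X : ¬ γ ≈ X
      γ≉X γ≈X = root-not-fixed r r-root (begin
        r ^ p              ≈⟨ r^p ⟩
        - (B + β + γ)      ≈⟨ -‿cong (+-congˡ γ≈X) ⟩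
        - (B + β + X)      ≈⟨ -‿cong (trans (+-assoc B β X) (trans (+-congˡ (+-comm β X)) (sym (+-assoc B X β)))) ⟩
        r                  ∎)

      γ≉β : ¬ γ ≈ β
      γ≉β γ≈β = β≉X (x∙y⁻¹≈ε⇒x≈y β X (^-≈0 p (β - X) (begin
        (β - X) ^ p        ≈⟨ ^p-distrib-+ p-prime β (- X) ⟩
        γ + (- X) ^ p      ≈⟨ +-congˡ (^p-distrib-neg p-prime X) ⟩
        γ - β              ≈⟨ x≈y⇒x∙y⁻¹≈ε γ≈β ⟩
        0#                 ∎)))

      γ≈r : γ ≈ r
      γ≈r = third-root (root⇒X⊎Q≈0 γ γ-root)
        where
        second-or-third : γ ≈ β ⊎ γ ≈ r → γ ≈ r
        second-or-third (inj₁ γ≈β) = ⊥-elim (γ≉β γ≈β)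
        second-or-third (inj₂ γ≈r) = γ≈r
        third-root : γ ≈ X ⊎ Q γ ≈ 0# → γ ≈ r
        third-root (inj₁ γ≈X)  = ⊥-elim (γ≉X γ≈X)
        third-root (inj₂ Qγ≈0) = second-or-third (Q≈0⇒β⊎r γ Qγ≈0)

      r^p≈X : r ^ p ≈ X
      r^p≈X = trans r^p (trans (-‿cong (+-congˡ γ≈r)) (identity B X β))
        where
        identity : ∀ B X β → - (B + β + - (B + X + β)) ≈ X
        identity = solve 3 (λ B X β → :- (B :+ β :+ :- (B :+ X :+ β)) := X) refl

      G : Carrier → Carrier
      G y = ι c₀ + y * (ι c₁ + y * ι c₂)

      eval-quadratic : ∀ y → eval y (c₀ ∷ c₁ ∷ c₂ ∷ []) ≈ G y
      eval-quadratic y = +-congˡ (*-congˡ (eval-[a,b] y c₁ c₂))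

      G-^p : ∀ y → G y ^ p ≈ G (y ^ p)
      G-^p y = trans (^-congˡ p (sym (eval-quadratic y))) (trans (^p-eval p-prime y (c₀ ∷ c₁ ∷ c₂ ∷ [])) (eval-quadratic (y ^ p)))

      GX≈β : G X ≈ β
      GX≈β = trans (sym (eval-quadratic X)) g[X]≈X^p

      Gβ≈r : G β ≈ r
      Gβ≈r = trans (sym (G-^p X)) (trans (^-congˡ p GX≈β) γ≈r)

      Gr≈X : G r ≈ X
      Gr≈X = begin
        G r            ≈⟨ G-cong (sym γ≈r) ⟩
        G γ            ≈⟨ G-^p β ⟨
        G β ^ p        ≈⟨ ^-congˡ p Gβ≈r ⟩
        r ^ p          ≈⟨ r^p≈X ⟩
        X              ∎
        where
        G-cong : ∀ {y z} → y ≈ z → G y ≈ G z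
        G-cong y≈z = +-congˡ (*-cong y≈z (+-congˡ (*-congʳ y≈z)))

      vieta₁ : - (X + β + r) ≈ B
      vieta₁ = identity X β B
        where
        identity : ∀ X β B → - (X + β + - (B + X + β)) ≈ B
        identity = solve 3 (λ X β B → :- (X :+ β :+ :- (B :+ X :+ β)) := B) refl

      vieta₂ : X * β + β * r + r * X ≈ C
      vieta₂ = begin
        X * β + β * r + r * X          ≈⟨ +-identityʳ _ ⟨
        X * β + β * r + r * X + 0#     ≈⟨ +-congˡ Qβ≈0 ⟨
        X * β + β * r + r * X + Q β    ≈⟨ identity X β B C ⟩
        C                              ∎
        where
        identity : ∀ X β B C → X * β + β * - (B + X + β) + - (B + X + β) * X + (β * β + (B + X) * β + (C + B * X + X * X)) ≈ C
        identity = solve 4 (λ X β B C → X :* β :+ β :* :- (B :+ X :+ β) :+ :- (B :+ X :+ β) :* X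
          :+ (β :* β :+ (B :+ X) :* β :+ (C :+ B :* X :+ X :* X)) := C) refl

      vieta₃ : - (X * β * r) ≈ D
      vieta₃ = begin
        - (X * β * r)                          ≈⟨ trans (+-identityʳ _) (+-identityʳ _) ⟨
        - (X * β * r) + 0# + 0#                ≈⟨ +-cong (+-congˡ FX≈0) (trans (-‿cong (trans (*-congˡ Qβ≈0) (zeroʳ X))) -0#≈0#) ⟨
        - (X * β * r) + F X - X * Q β          ≈⟨ identity X β B C D ⟩
        D                                      ∎
        where
        open import Algebra.Properties.Ring ring using (-0#≈0#)
        identity : ∀ X β B C D → - (X * β * - (B + X + β)) + (D + X * (C + X * (B + X * ι 1ℤ)))
          - X * (β * β + (B + X) * β + (C + B * X + X * X)) ≈ D
        identity = solve 5 (λ X β B C D → :- (X :* β :* :- (B :+ X :+ β)) :+ (D :+ X :* (C :+ X :* (B :+ X :* con 1ℤ)))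
          :- X :* (β :* β :+ (B :+ X) :* β :+ (C :+ B :* X :+ X :* X)) := D) refl

      δ K : Carrier
      δ = (X - β) * (β - r) * (r - X)
      K = (β - r) * (β - r) - (X - β) * (r - X)

      K≈ι[b²-3c] : K ≈ ι (b ℤ.* b ℤ.- + 3 ℤ.* c)
      K≈ι[b²-3c] = begin
        K                                                               ≈⟨ b²-3c-of-roots X β r ⟩
        - (X + β + r) * - (X + β + r) - ι (+ 3) * (X * β + β * r + r * X) ≈⟨ +-cong (*-cong vieta₁ vieta₁) (-‿cong (*-congˡ vieta₂)) ⟩
        B * B - ι (+ 3) * C                                             ≈⟨ ι-[b²-3c] b c ⟨
        ι (b ℤ.* b ℤ.- + 3 ℤ.* c)                                       ∎

      δ²≈ι[discriminant] : δ * δ ≈ ι (discriminantℤ b c d)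
      δ²≈ι[discriminant] = trans (discriminant-of-roots X β r)
        (trans (discriminant-cong vieta₁ vieta₂ vieta₃) (sym (ι-discriminant b c d)))

      c₂δ+K≈0 : ι c₂ * δ + K ≈ 0#
      c₂δ+K≈0 = begin
        ι c₂ * δ + K                  ≈⟨ identity X β r (ι c₀) (ι c₁) (ι c₂) ⟩
        defect (G X) (G β) (G r)      ≈⟨ +-cong (+-cong (*-congˡ (+-congʳ Gβ≈r)) (-‿cong (*-congˡ (+-congʳ GX≈β)))) (-‿cong (*-congˡ (+-congʳ Gr≈X))) ⟩
        defect β r X                  ≈⟨ vanish X β r ⟩
        ι 0ℤ                          ≈⟨ ι-0 ⟩
        0#                            ∎
        where
        defect : Carrier → Carrier → Carrier → Carrier
        defect u v w = (X - r) * (v - r) - (β - r) * (u - β) - (X - β) * (w - X)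
        identity : ∀ X β r C₀ C₁ C₂ →
          C₂ * ((X - β) * (β - r) * (r - X)) + ((β - r) * (β - r) - (X - β) * (r - X)) ≈
          (X - r) * ((C₀ + β * (C₁ + β * C₂)) - r) - (β - r) * ((C₀ + X * (C₁ + X * C₂)) - β)
            - (X - β) * ((C₀ + r * (C₁ + r * C₂)) - X)
        identity = solve 6 (λ X β r C₀ C₁ C₂ →
          C₂ :* ((X :- β) :* (β :- r) :* (r :- X)) :+ ((β :- r) :* (β :- r) :- (X :- β) :* (r :- X)) :=
          (X :- r) :* ((C₀ :+ β :* (C₁ :+ β :* C₂)) :- r) :- (β :- r) :* ((C₀ :+ X :* (C₁ :+ X :* C₂)) :- β)
            :- (X :- β) :* ((C₀ :+ r :* (C₁ :+ r :* C₂)) :- X)) refl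
        vanish : ∀ X β r → (X - r) * (r - r) - (β - r) * (β - β) - (X - β) * (X - X) ≈ ι 0ℤ
        vanish = solve 3 (λ X β r → (X :- r) :* (r :- r) :- (β :- r) :* (β :- β) :- (X :- β) :* (X :- X) := con 0ℤ) refl

      c₂-nonzero : ¬ ι (b ℤ.* b ℤ.- + 3 ℤ.* c) ≈ 0# → ¬ ι c₂ ≈ 0#
      c₂-nonzero b²-3c≉0 c₂≈0 = b²-3c≉0 (begin
        ι (b ℤ.* b ℤ.- + 3 ℤ.* c)    ≈⟨ K≈ι[b²-3c] ⟨
        K                            ≈⟨ +-identityˡ K ⟨
        0# + K                       ≈⟨ +-congʳ (trans (*-congʳ c₂≈0) (zeroˡ δ)) ⟨
        ι c₂ * δ + K                 ≈⟨ c₂δ+K≈0 ⟩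
        0#                           ∎)

      t≈-δ : ∀ t → ι t * ι c₂ ≈ K → ¬ ι c₂ ≈ 0# → ι t ≈ - δ
      t≈-δ t tc₂≈K c₂≉0 = cancel-c₂ (no-zero-divisors (ι c₂) (ι t + δ) (begin
        ι c₂ * (ι t + δ)             ≈⟨ distribˡ (ι c₂) (ι t) δ ⟩
        ι c₂ * ι t + ι c₂ * δ        ≈⟨ +-cong (trans (*-comm (ι c₂) (ι t)) tc₂≈K) refl ⟩
        K + ι c₂ * δ                 ≈⟨ +-comm K (ι c₂ * δ) ⟩
        ι c₂ * δ + K                 ≈⟨ c₂δ+K≈0 ⟩
        0#                           ∎))
        where
        open import Algebra.Properties.Group +-group using (inverseˡ-unique)
        cancel-c₂ : ι c₂ ≈ 0# ⊎ ι t + δ ≈ 0# → ι t ≈ - δ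
        cancel-c₂ (inj₁ c₂≈0)  = ⊥-elim (c₂≉0 c₂≈0)
        cancel-c₂ (inj₂ t+δ≈0) = inverseˡ-unique (ι t) δ t+δ≈0

      t²≈ι[discriminant] : ∀ t → ι t * ι c₂ ≈ K → ¬ ι c₂ ≈ 0# → ι t * ι t ≈ ι (discriminantℤ b c d)
      t²≈ι[discriminant] t tc₂≈K c₂≉0 = begin
        ι t * ι t        ≈⟨ *-cong (t≈-δ t tc₂≈K c₂≉0) (t≈-δ t tc₂≈K c₂≉0) ⟩
        - δ * - δ        ≈⟨ solve 1 (λ δ → :- δ :* :- δ := δ :* δ) refl δ ⟩
        δ * δ            ≈⟨ δ²≈ι[discriminant] ⟩
        ι (discriminantℤ b c d)  ∎

module Invertibility {c ℓ : Level} (R : CommutativeRing c ℓ) where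
  open CommutativeRing R
  open import Algebra.Definitions _≈_ using (RightInvertible)
  open import Algebra.Properties.CommutativeSemigroup *-commutativeSemigroup using (interchange; xy∙z≈y∙xz)
  open import Relation.Binary.Reasoning.Setoid setoid

  Unit : Carrier → Set _
  Unit = RightInvertible 1# _*_

  unit-* : ∀ {u v} → Unit u → Unit v → Unit (u * v)
  unit-* {u} {v} (u⁻¹ , uu⁻¹≈1) (v⁻¹ , vv⁻¹≈1) = u⁻¹ * v⁻¹ , (begin
    (u * v) * (u⁻¹ * v⁻¹)    ≈⟨ interchange u v u⁻¹ v⁻¹ ⟩
    (u * u⁻¹) * (v * v⁻¹)    ≈⟨ *-cong uu⁻¹≈1 vv⁻¹≈1 ⟩
    1# * 1#                  ≈⟨ *-identityˡ 1# ⟩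
    1#                       ∎)

  unit-resp-≈ : ∀ {u v} → u ≈ v → Unit u → Unit v
  unit-resp-≈ u≈v (u⁻¹ , uu⁻¹≈1) = u⁻¹ , trans (*-congʳ (sym u≈v)) uu⁻¹≈1

  unit-factor : ∀ {u v} → Unit (u * v) → Unit v
  unit-factor {u} {v} (w , uvw≈1) = u * w , trans (sym (xy∙z≈y∙xz u v w)) uvw≈1

  unit-factorˡ : ∀ {u v} → Unit (u * v) → Unit u
  unit-factorˡ {u} {v} uv-unit = unit-factor (unit-resp-≈ (*-comm u v) uv-unit)

  unit-cancel : ∀ {u v} → Unit u → u * v ≈ 0# → v ≈ 0#
  unit-cancel {u} {v} (u⁻¹ , uu⁻¹≈1) uv≈0 = begin
    v                  ≈⟨ *-identityˡ v ⟨
    1# * v             ≈⟨ *-congʳ uu⁻¹≈1 ⟨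
    (u * u⁻¹) * v      ≈⟨ xy∙z≈y∙xz u u⁻¹ v ⟩
    u⁻¹ * (u * v)      ≈⟨ *-congˡ uv≈0 ⟩
    u⁻¹ * 0#           ≈⟨ zeroʳ u⁻¹ ⟩
    0#                 ∎

  zero-or-unit⇒no-zero-divisors : (∀ u → u ≈ 0# ⊎ Unit u) → ∀ u v → u * v ≈ 0# → u ≈ 0# ⊎ v ≈ 0#
  zero-or-unit⇒no-zero-divisors zero-or-unit u v uv≈0 with zero-or-unit u
  ... | inj₁ u≈0    = inj₁ u≈0
  ... | inj₂ u-unit = inj₂ (unit-cancel u-unit uv≈0)

record ℤ³ : Set where
  constructor ⟨_,_,_⟩
  field
    coeff₀ coeff₁ coeff₂ : ℤ

-- ⟨ a₀ , a₁ , a₂ ⟩ stands for a₀ + a₁ x + a₂ x², and x³ = - b x² - c x - d.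
module CubicQuotient (p : ℕ) (b c d : ℤ) where

  module Arithmetic where
    open ℤ³
    open import Data.Integer using (_+_; _*_; _-_; -_)
    open Modulo p using (_≡ₚ_; ≡ₚ-refl; ≡ₚ-reflexive; ≡ₚ-sym; ≡ₚ-trans; neg-cong)
      renaming (+-cong to +-congₚ; *-cong to *-congₚ)

    infix 4 _≈ᵀ_
    record _≈ᵀ_ (u v : ℤ³) : Set where
      constructor componentwise
      field
        ≈₀ : coeff₀ u ≡ₚ coeff₀ v
        ≈₁ : coeff₁ u ≡ₚ coeff₁ v
        ≈₂ : coeff₂ u ≡ₚ coeff₂ v

    exactly : ∀ {u v} → coeff₀ u ≡ coeff₀ v → coeff₁ u ≡ coeff₁ v → coeff₂ u ≡ coeff₂ v → u ≈ᵀ v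
    exactly e₀ e₁ e₂ = componentwise (≡ₚ-reflexive e₀) (≡ₚ-reflexive e₁) (≡ₚ-reflexive e₂)

    -- INLINE lets the ring solver see the polynomial components of every product.
    infixl 6 _⊞_
    infixl 7 _⊠_
    _⊞_ : ℤ³ → ℤ³ → ℤ³
    u ⊞ v = ⟨ coeff₀ u + coeff₀ v , coeff₁ u + coeff₁ v , coeff₂ u + coeff₂ v ⟩
    {-# INLINE _⊞_ #-}

    ⊟_ : ℤ³ → ℤ³
    ⊟ u = ⟨ - coeff₀ u , - coeff₁ u , - coeff₂ u ⟩
    {-# INLINE ⊟_ #-}

    _⊠_ : ℤ³ → ℤ³ → ℤ³
    u ⊠ v =
      let u₀ = coeff₀ u ; u₁ = coeff₁ u ; u₂ = coeff₂ u
          v₀ = coeff₀ v ; v₁ = coeff₁ v ; v₂ = coeff₂ v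
      in
      ⟨ u₀ * v₀ - d * (u₁ * v₂ + u₂ * v₁) + b * d * (u₂ * v₂)
      , u₀ * v₁ + u₁ * v₀ - c * (u₁ * v₂ + u₂ * v₁) + (b * c - d) * (u₂ * v₂)
      , u₀ * v₂ + u₁ * v₁ + u₂ * v₀ - b * (u₁ * v₂ + u₂ * v₁) + (b * b - c) * (u₂ * v₂) ⟩
    {-# INLINE _⊠_ #-}

    ι : ℤ → ℤ³
    ι a = ⟨ a , 0ℤ , 0ℤ ⟩
    {-# INLINE ι #-}

    x : ℤ³
    x = ⟨ 0ℤ , 1ℤ , 0ℤ ⟩
    {-# INLINE x #-}

    *-assoc : ∀ u v w → (u ⊠ v) ⊠ w ≈ᵀ u ⊠ (v ⊠ w)
    *-assoc ⟨ a₀ , a₁ , a₂ ⟩ ⟨ e₀ , e₁ , e₂ ⟩ ⟨ g₀ , g₁ , g₂ ⟩ =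
      exactly (ℤ-Solver.solve vars) (ℤ-Solver.solve vars) (ℤ-Solver.solve vars)
      where
        vars : List ℤ
        vars = b ∷ c ∷ d ∷ a₀ ∷ a₁ ∷ a₂ ∷ e₀ ∷ e₁ ∷ e₂ ∷ g₀ ∷ g₁ ∷ g₂ ∷ []

    *-comm : ∀ u v → u ⊠ v ≈ᵀ v ⊠ u
    *-comm ⟨ a₀ , a₁ , a₂ ⟩ ⟨ e₀ , e₁ , e₂ ⟩ =
      exactly (ℤ-Solver.solve vars) (ℤ-Solver.solve vars) (ℤ-Solver.solve vars)
      where
        vars : List ℤ
        vars = b ∷ c ∷ d ∷ a₀ ∷ a₁ ∷ a₂ ∷ e₀ ∷ e₁ ∷ e₂ ∷ []

    *-distribˡ-+ : ∀ u v w → u ⊠ (v ⊞ w) ≈ᵀ u ⊠ v ⊞ u ⊠ w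
    *-distribˡ-+ ⟨ a₀ , a₁ , a₂ ⟩ ⟨ e₀ , e₁ , e₂ ⟩ ⟨ g₀ , g₁ , g₂ ⟩ =
      exactly (ℤ-Solver.solve vars) (ℤ-Solver.solve vars) (ℤ-Solver.solve vars)
      where
        vars : List ℤ
        vars = b ∷ c ∷ d ∷ a₀ ∷ a₁ ∷ a₂ ∷ e₀ ∷ e₁ ∷ e₂ ∷ g₀ ∷ g₁ ∷ g₂ ∷ []

    *-distribʳ-+ : ∀ u v w → (v ⊞ w) ⊠ u ≈ᵀ v ⊠ u ⊞ w ⊠ u
    *-distribʳ-+ ⟨ a₀ , a₁ , a₂ ⟩ ⟨ e₀ , e₁ , e₂ ⟩ ⟨ g₀ , g₁ , g₂ ⟩ =
      exactly (ℤ-Solver.solve vars) (ℤ-Solver.solve vars) (ℤ-Solver.solve vars)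
      where
        vars : List ℤ
        vars = b ∷ c ∷ d ∷ a₀ ∷ a₁ ∷ a₂ ∷ e₀ ∷ e₁ ∷ e₂ ∷ g₀ ∷ g₁ ∷ g₂ ∷ []

    *-identityˡ : ∀ u → ι 1ℤ ⊠ u ≈ᵀ u
    *-identityˡ ⟨ a₀ , a₁ , a₂ ⟩ = exactly (ℤ-Solver.solve vars) (ℤ-Solver.solve vars) (ℤ-Solver.solve vars)
      where
        vars : List ℤ
        vars = b ∷ c ∷ d ∷ a₀ ∷ a₁ ∷ a₂ ∷ []

    *-identityʳ : ∀ u → u ⊠ ι 1ℤ ≈ᵀ u
    *-identityʳ ⟨ a₀ , a₁ , a₂ ⟩ = exactly (ℤ-Solver.solve vars) (ℤ-Solver.solve vars) (ℤ-Solver.solve vars)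
      where
        vars : List ℤ
        vars = b ∷ c ∷ d ∷ a₀ ∷ a₁ ∷ a₂ ∷ []

    +-assoc : ∀ u v w → (u ⊞ v) ⊞ w ≈ᵀ u ⊞ (v ⊞ w)
    +-assoc ⟨ a₀ , a₁ , a₂ ⟩ ⟨ e₀ , e₁ , e₂ ⟩ ⟨ g₀ , g₁ , g₂ ⟩ =
      exactly (ℤ.+-assoc a₀ e₀ g₀) (ℤ.+-assoc a₁ e₁ g₁) (ℤ.+-assoc a₂ e₂ g₂)

    +-comm : ∀ u v → u ⊞ v ≈ᵀ v ⊞ u
    +-comm ⟨ a₀ , a₁ , a₂ ⟩ ⟨ e₀ , e₁ , e₂ ⟩ = exactly (ℤ.+-comm a₀ e₀) (ℤ.+-comm a₁ e₁) (ℤ.+-comm a₂ e₂)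

    +-identityˡ : ∀ u → ι 0ℤ ⊞ u ≈ᵀ u
    +-identityˡ ⟨ a₀ , a₁ , a₂ ⟩ = exactly (ℤ.+-identityˡ a₀) (ℤ.+-identityˡ a₁) (ℤ.+-identityˡ a₂)

    +-identityʳ : ∀ u → u ⊞ ι 0ℤ ≈ᵀ u
    +-identityʳ ⟨ a₀ , a₁ , a₂ ⟩ = exactly (ℤ.+-identityʳ a₀) (ℤ.+-identityʳ a₁) (ℤ.+-identityʳ a₂)

    -‿inverseˡ : ∀ u → ⊟ u ⊞ u ≈ᵀ ι 0ℤ
    -‿inverseˡ ⟨ a₀ , a₁ , a₂ ⟩ = exactly (ℤ.+-inverseˡ a₀) (ℤ.+-inverseˡ a₁) (ℤ.+-inverseˡ a₂)

    -‿inverseʳ : ∀ u → u ⊞ ⊟ u ≈ᵀ ι 0ℤ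
    -‿inverseʳ ⟨ a₀ , a₁ , a₂ ⟩ = exactly (ℤ.+-inverseʳ a₀) (ℤ.+-inverseʳ a₁) (ℤ.+-inverseʳ a₂)

    +-cong : ∀ {u u′ v v′} → u ≈ᵀ u′ → v ≈ᵀ v′ → u ⊞ v ≈ᵀ u′ ⊞ v′
    +-cong (componentwise u₀ u₁ u₂) (componentwise v₀ v₁ v₂) =
      componentwise (+-congₚ u₀ v₀) (+-congₚ u₁ v₁) (+-congₚ u₂ v₂)

    -‿cong : ∀ {u u′} → u ≈ᵀ u′ → ⊟ u ≈ᵀ ⊟ u′
    -‿cong (componentwise u₀ u₁ u₂) = componentwise (neg-cong u₀) (neg-cong u₁) (neg-cong u₂)

    *-cong : ∀ {u u′ v v′} → u ≈ᵀ u′ → v ≈ᵀ v′ → u ⊠ v ≈ᵀ u′ ⊠ v′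
    *-cong {u} {u′} {v} {v′} (componentwise u₀ u₁ u₂) (componentwise v₀ v₁ v₂) =
      componentwise
        (+-congₚ (+-congₚ (*-congₚ u₀ v₀) (neg-cong (scale d cross))) (scale (b * d) (*-congₚ u₂ v₂)))
        (+-congₚ (+-congₚ (+-congₚ (*-congₚ u₀ v₁) (*-congₚ u₁ v₀)) (neg-cong (scale c cross)))
                 (scale (b * c - d) (*-congₚ u₂ v₂)))
        (+-congₚ (+-congₚ (+-congₚ (+-congₚ (*-congₚ u₀ v₂) (*-congₚ u₁ v₁)) (*-congₚ u₂ v₀)) (neg-cong (scale b cross)))
                 (scale (b * b - c) (*-congₚ u₂ v₂)))
      where
      scale : ∀ k {y z} → y ≡ₚ z → k * y ≡ₚ k * z
      scale k = *-congₚ (≡ₚ-refl {k})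
      cross : coeff₁ u * coeff₂ v + coeff₂ u * coeff₁ v ≡ₚ coeff₁ u′ * coeff₂ v′ + coeff₂ u′ * coeff₁ v′
      cross = +-congₚ (*-congₚ u₁ v₂) (*-congₚ u₂ v₁)

    ≈ᵀ-isEquivalence : IsEquivalence _≈ᵀ_
    ≈ᵀ-isEquivalence = record
      { refl  = componentwise ≡ₚ-refl ≡ₚ-refl ≡ₚ-refl
      ; sym   = λ (componentwise u₀ u₁ u₂) → componentwise (≡ₚ-sym u₀) (≡ₚ-sym u₁) (≡ₚ-sym u₂)
      ; trans = λ (componentwise u₀ u₁ u₂) (componentwise v₀ v₁ v₂) →
                  componentwise (≡ₚ-trans u₀ v₀) (≡ₚ-trans u₁ v₁) (≡ₚ-trans u₂ v₂)
      }

    quotientRing : CommutativeRing 0ℓ 0ℓ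
    quotientRing = record
      { Carrier = ℤ³ ; _≈_ = _≈ᵀ_ ; _+_ = _⊞_ ; _*_ = _⊠_ ; -_ = ⊟_ ; 0# = ι 0ℤ ; 1# = ι 1ℤ
      ; isCommutativeRing = record
        { isRing = record
          { +-isAbelianGroup = record
            { isGroup = record
              { isMonoid = record
                { isSemigroup = record
                  { isMagma = record { isEquivalence = ≈ᵀ-isEquivalence ; ∙-cong = +-cong }
                  ; assoc = +-assoc }
                ; identity = +-identityˡ , +-identityʳ }
              ; inverse = -‿inverseˡ , -‿inverseʳ
              ; ⁻¹-cong = -‿cong }
            ; comm = +-comm }
          ; *-cong = *-cong
          ; *-assoc = *-assoc
          ; *-identity = *-identityˡ , *-identityʳ
          ; distrib = *-distribˡ-+ , *-distribʳ-+ }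
        ; *-comm = *-comm } }

    ι-* : ∀ a e → ι (a * e) ≈ᵀ ι a ⊠ ι e
    ι-* a e = exactly (ℤ-Solver.solve vars) (ℤ-Solver.solve vars) (ℤ-Solver.solve vars)
      where
        vars : List ℤ
        vars = b ∷ c ∷ d ∷ a ∷ e ∷ []

    ι-isRingHomomorphism : RingMorphisms.IsRingHomomorphism
      (CommutativeRing.rawRing (Modulo.ℤ/p p)) (CommutativeRing.rawRing quotientRing) ι
    ι-isRingHomomorphism = record
      { isSemiringHomomorphism = record
        { isNearSemiringHomomorphism = record
          { +-isMonoidHomomorphism = record
            { isMagmaHomomorphism = record
              { isRelHomomorphism = record { cong = λ a≡e → componentwise a≡e ≡ₚ-refl ≡ₚ-refl }
              ; homo = λ a e → exactly ≡.refl ≡.refl ≡.refl }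
            ; ε-homo = exactly ≡.refl ≡.refl ≡.refl }
          ; *-homo = ι-* }
        ; 1#-homo = exactly ≡.refl ≡.refl ≡.refl }
      ; -‿homo = λ a → exactly ≡.refl ≡.refl ≡.refl }

    open ℤ/p-Algebra quotientRing ι ι-isRingHomomorphism using (eval)

    x-root : eval x (d ∷ c ∷ b ∷ 1ℤ ∷ []) ≈ᵀ ι 0ℤ
    x-root = ≈ᵀ-trans (horner d (c ∷ b ∷ 1ℤ ∷ []) (horner c (b ∷ 1ℤ ∷ []) (horner b (1ℤ ∷ []) (horner 1ℤ [] ≈ᵀ-refl))))
                      (exactly (ℤ-Solver.solve (b ∷ c ∷ d ∷ [])) (ℤ-Solver.solve (b ∷ c ∷ d ∷ [])) (ℤ-Solver.solve (b ∷ c ∷ d ∷ [])))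
      where
      open IsEquivalence ≈ᵀ-isEquivalence using () renaming (refl to ≈ᵀ-refl; trans to ≈ᵀ-trans)
      x-shift : ∀ a u → ι a ⊞ x ⊠ u ≈ᵀ ⟨ a - d * coeff₂ u , coeff₀ u - c * coeff₂ u , coeff₁ u - b * coeff₂ u ⟩
      x-shift a ⟨ a₀ , a₁ , a₂ ⟩ = exactly (ℤ-Solver.solve vars) (ℤ-Solver.solve vars) (ℤ-Solver.solve vars)
        where
          vars : List ℤ
          vars = b ∷ c ∷ d ∷ a ∷ a₀ ∷ a₁ ∷ a₂ ∷ []
      horner : ∀ a f {u} → eval x f ≈ᵀ u → eval x (a ∷ f) ≈ᵀ ⟨ a - d * coeff₂ u , coeff₀ u - c * coeff₂ u , coeff₁ u - b * coeff₂ u ⟩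
      horner a f {u} f≈u = ≈ᵀ-trans (+-cong (≈ᵀ-refl {ι a}) (*-cong (≈ᵀ-refl {x}) f≈u)) (x-shift a u)

  open Arithmetic public using (_≈ᵀ_; componentwise; exactly; _⊠_; quotientRing; ι; ι-isRingHomomorphism; x; x-root)
  open CommutativeRing quotientRing
  open ℤ/p-Algebra quotientRing ι ι-isRingHomomorphism public
  open import Relation.Binary.Reasoning.Setoid setoid

  ι-injective : ∀ {a e} → ι a ≈ ι e → Modulo._≡ₚ_ p a e
  ι-injective = _≈ᵀ_.≈₀

  x^p≈g[x] : ∀ g → PolyCongMod p (d ∷ c ∷ b ∷ 1ℤ ∷ []) (X^ p) g → x ^ p ≈ eval x g
  x^p≈g[x] g (q , x^p≡qf+g) = begin
    x ^ p                                ≈⟨ eval-X^ x p ⟨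
    eval x (X^ p)                        ≈⟨ eval-cong x (X^ p) (q ⊛ f ⊕ g) (λ i → Modulo.ModEq⇒≡ₚ p (x^p≡qf+g i)) ⟩
    eval x (q ⊛ f ⊕ g)                   ≈⟨ eval-⊕ x (q ⊛ f) g ⟩
    eval x (q ⊛ f) + eval x g            ≈⟨ +-cong (eval-⊛ x q f) (refl {eval x g}) ⟩
    eval x q * eval x f + eval x g       ≈⟨ +-cong (*-cong (refl {eval x q}) x-root) (refl {eval x g}) ⟩
    eval x q * 0# + eval x g             ≈⟨ +-cong (zeroʳ (eval x q)) (refl {eval x g}) ⟩
    0# + eval x g                        ≈⟨ +-identityˡ (eval x g) ⟩
    eval x g                             ∎
    where
    f : Poly
    f = d ∷ c ∷ b ∷ 1ℤ ∷ []

module IrreducibleCubic {p : ℕ} (p-prime : Prime p) (b c d : ℤ)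
  (irreducible : IrreducibleMod p (d ∷ c ∷ b ∷ 1ℤ ∷ [])) where
  open Modulo p
  open import Data.Integer using (_+_; _*_; _-_; -_)

  no-linear-factor : ∀ k q₀ q₁ → d ≡ₚ k * q₀ → c ≡ₚ k * q₁ + q₀ → b ≡ₚ k + q₁ → ⊥
  no-linear-factor k q₀ q₁ d≡ c≡ b≡ =
    proj₂ irreducible (g , h , (0 , leading-1≢0) , (1 , leading-1≢0) , f≡gh)
    where
    g h : Poly
    g = k ∷ 1ℤ ∷ []
    h = q₀ ∷ q₁ ∷ 1ℤ ∷ []
    constant-term : ∀ k q₀ → k * q₀ ≡ k * q₀ + 0ℤ
    constant-term = ℤ-Solver.solve-∀
    linear-term : ∀ k q₀ q₁ → k * q₁ + q₀ ≡ k * q₁ + (1ℤ * q₀ + 0ℤ)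
    linear-term = ℤ-Solver.solve-∀
    quadratic-term : ∀ k q₁ → k + q₁ ≡ k * 1ℤ + 1ℤ * q₁
    quadratic-term = ℤ-Solver.solve-∀
    leading-1≢0 : ¬ ModEq p 1ℤ 0ℤ
    leading-1≢0 1≡0 = 1≢ₚ0 p-prime (ModEq⇒≡ₚ 1≡0)
    f≡gh : PolyEqMod p (d ∷ c ∷ b ∷ 1ℤ ∷ []) (g ⊛ h)
    f≡gh 0 = ≡ₚ⇒ModEq {d} {coeff (g ⊛ h) 0} (≡ₚ-trans d≡ (≡ₚ-reflexive (constant-term k q₀)))
    f≡gh 1 = ≡ₚ⇒ModEq {c} {coeff (g ⊛ h) 1} (≡ₚ-trans c≡ (≡ₚ-reflexive (linear-term k q₀ q₁)))
    f≡gh 2 = ≡ₚ⇒ModEq {b} {coeff (g ⊛ h) 2} (≡ₚ-trans b≡ (≡ₚ-reflexive (quadratic-term k q₁)))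
    f≡gh 3 = ≡ₚ⇒ModEq {1ℤ} {coeff (g ⊛ h) 3} ≡ₚ-refl
    f≡gh (suc (suc (suc (suc i)))) = ≡ₚ⇒ModEq {0ℤ} {0ℤ} ≡ₚ-refl

  no-root : ∀ a → ¬ d + a * (c + a * (b + a * 1ℤ)) ≡ₚ 0ℤ
  no-root a root = no-linear-factor (- a) q₀ (b + a) d≡ (≡ₚ-reflexive (c-split a b c)) (≡ₚ-reflexive (b-split a b))
    where
    q₀ : ℤ
    q₀ = c + b * a + a * a
    d-split : ∀ a b c d → d ≡ - a * (c + b * a + a * a) + (d + a * (c + a * (b + a * 1ℤ)))
    d-split = ℤ-Solver.solve-∀
    c-split : ∀ a b c → c ≡ - a * (b + a) + (c + b * a + a * a)
    c-split = ℤ-Solver.solve-∀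
    b-split : ∀ a b → b ≡ - a + (b + a)
    b-split = ℤ-Solver.solve-∀
    d≡ : d ≡ₚ - a * q₀
    d≡ = ≡ₚ-trans (≡ₚ-reflexive (d-split a b c d))
           (≡ₚ-trans (+-cong (≡ₚ-refl { - a * q₀}) root) (≡ₚ-reflexive (ℤ.+-identityʳ (- a * q₀))))

module CubicQuotientField {p : ℕ} (p-prime : Prime p) (b c d : ℤ)
  (irreducible : IrreducibleMod p (d ∷ c ∷ b ∷ 1ℤ ∷ [])) where
  open import Data.Product using (_×_)
  open CubicQuotient p b c d
  open CommutativeRing quotientRing
  open Invertibility quotientRing
  open IrreducibleCubic p-prime b c d irreducible using (no-linear-factor; no-root)
  open Modulo p using (_≡ₚ_; ≡ₚ-refl; ≡ₚ-sym; ≡ₚ-trans; ≡ₚ-reflexive; ≡ₚ0?; inverse)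
    renaming (+-cong to +-congₚ; *-cong to *-congₚ; neg-cong to neg-congₚ)

  -v≡ₚ0⇒v≡ₚ0 : ∀ {v} → ℤ.- v ≡ₚ 0ℤ → v ≡ₚ 0ℤ
  -v≡ₚ0⇒v≡ₚ0 {v} -v≡0 = ≡ₚ-trans (≡ₚ-reflexive (≡.sym (ℤ.neg-involutive v))) (neg-congₚ -v≡0)

  unit-scalar : ∀ {a} → ¬ a ≡ₚ 0ℤ → Unit (ι a)
  unit-scalar {a} a≢0 with inverse p-prime a a≢0
  ... | a⁻¹ , aa⁻¹≡1 = ι a⁻¹ , trans (sym (ι-* a a⁻¹)) (ι-cong aa⁻¹≡1)

  [x-a]*quotient≈-f[a] : ∀ a →
    ⟨ ℤ.- a , 1ℤ , 0ℤ ⟩ ⊠ ⟨ c ℤ.+ b ℤ.* a ℤ.+ a ℤ.* a , b ℤ.+ a , 1ℤ ⟩ ≈ ι (ℤ.- (d ℤ.+ a ℤ.* (c ℤ.+ a ℤ.* (b ℤ.+ a ℤ.* 1ℤ))))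
  [x-a]*quotient≈-f[a] a = exactly (ℤ-Solver.solve vars) (ℤ-Solver.solve vars) (ℤ-Solver.solve vars)
    where
      vars : List ℤ
      vars = b ∷ c ∷ d ∷ a ∷ []

  [x²+w₁x+w₀]*[x+b-w₁]≈remainder : ∀ w₀ w₁ →
    ⟨ w₀ , w₁ , 1ℤ ⟩ ⊠ ⟨ b ℤ.- w₁ , 1ℤ , 0ℤ ⟩ ≈ ⟨ ℤ.- (d ℤ.- w₀ ℤ.* (b ℤ.- w₁)) , ℤ.- (c ℤ.- w₀ ℤ.- w₁ ℤ.* (b ℤ.- w₁)) , 0ℤ ⟩
  [x²+w₁x+w₀]*[x+b-w₁]≈remainder w₀ w₁ = exactly (ℤ-Solver.solve vars) (ℤ-Solver.solve vars) (ℤ-Solver.solve vars)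
    where
      vars : List ℤ
      vars = b ∷ c ∷ d ∷ w₀ ∷ w₁ ∷ []

  scale-linear : ∀ s a → ι s ⊠ ⟨ a , 1ℤ , 0ℤ ⟩ ≈ ⟨ s ℤ.* a , s , 0ℤ ⟩
  scale-linear s a = exactly (ℤ-Solver.solve vars) (ℤ-Solver.solve vars) (ℤ-Solver.solve vars)
    where
      vars : List ℤ
      vars = b ∷ c ∷ d ∷ s ∷ a ∷ []

  scale-monic-quadratic : ∀ s w₀ w₁ → ι s ⊠ ⟨ w₀ , w₁ , 1ℤ ⟩ ≈ ⟨ s ℤ.* w₀ , s ℤ.* w₁ , s ⟩
  scale-monic-quadratic s w₀ w₁ = exactly (ℤ-Solver.solve vars) (ℤ-Solver.solve vars) (ℤ-Solver.solve vars)
    where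
      vars : List ℤ
      vars = b ∷ c ∷ d ∷ s ∷ w₀ ∷ w₁ ∷ []

  cancel-inverse : ∀ s i → s ℤ.* i ≡ₚ 1ℤ → ∀ v → s ℤ.* (v ℤ.* i) ≡ₚ v
  cancel-inverse s i si≡1 v = ≡ₚ-trans (≡ₚ-reflexive (regroup s v i))
    (≡ₚ-trans (*-congₚ (≡ₚ-refl {v}) si≡1) (≡ₚ-reflexive (ℤ.*-identityʳ v)))
    where
    regroup : ∀ s v i → s ℤ.* (v ℤ.* i) ≡ v ℤ.* (s ℤ.* i)
    regroup = ℤ-Solver.solve-∀

  unit-x-a : ∀ a → Unit ⟨ ℤ.- a , 1ℤ , 0ℤ ⟩
  unit-x-a a = unit-factorˡ {u = ⟨ ℤ.- a , 1ℤ , 0ℤ ⟩} (unit-resp-≈ (sym ([x-a]*quotient≈-f[a] a))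
    (unit-scalar (λ -f[a]≡0 → no-root a (-v≡ₚ0⇒v≡ₚ0 -f[a]≡0))))

  unit-linear : ∀ u₀ u₁ u₂ → u₂ ≡ₚ 0ℤ → ¬ (u₀ ≡ₚ 0ℤ × u₁ ≡ₚ 0ℤ) → Unit ⟨ u₀ , u₁ , u₂ ⟩
  unit-linear u₀ u₁ u₂ u₂≡0 u≢0 with ≡ₚ0? p-prime u₁
  ... | yes u₁≡0 = unit-resp-≈ {u = ι u₀} (componentwise ≡ₚ-refl (≡ₚ-sym u₁≡0) (≡ₚ-sym u₂≡0))
                     (unit-scalar (λ u₀≡0 → u≢0 (u₀≡0 , u₁≡0)))
  ... | no u₁≢0 with inverse p-prime u₁ u₁≢0
  ...   | i , u₁i≡1 = unit-resp-≈ {u = ι u₁ * ⟨ u₀ ℤ.* i , 1ℤ , 0ℤ ⟩}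
                        (trans (scale-linear u₁ (u₀ ℤ.* i)) (componentwise (cancel-inverse u₁ i u₁i≡1 u₀) ≡ₚ-refl (≡ₚ-sym u₂≡0)))
                        (unit-* {u = ι u₁} (unit-scalar u₁≢0) x-[-u₀i]-unit)
    where
    x-[-u₀i]-unit : Unit ⟨ u₀ ℤ.* i , 1ℤ , 0ℤ ⟩
    x-[-u₀i]-unit = unit-resp-≈ {u = ⟨ ℤ.- (ℤ.- (u₀ ℤ.* i)) , 1ℤ , 0ℤ ⟩}
      (exactly (ℤ.neg-involutive (u₀ ℤ.* i)) ≡.refl ≡.refl) (unit-x-a (ℤ.- (u₀ ℤ.* i)))

  unit-monic-quadratic : ∀ w₀ w₁ → Unit ⟨ w₀ , w₁ , 1ℤ ⟩
  unit-monic-quadratic w₀ w₁ =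
    unit-factorˡ {u = ⟨ w₀ , w₁ , 1ℤ ⟩} {v = ⟨ k , 1ℤ , 0ℤ ⟩}
      (unit-resp-≈ (sym ([x²+w₁x+w₀]*[x+b-w₁]≈remainder w₀ w₁)) (unit-linear (ℤ.- l₀) (ℤ.- l₁) 0ℤ ≡ₚ-refl remainder≢0))
    where
    k l₀ l₁ : ℤ
    k  = b ℤ.- w₁
    l₀ = d ℤ.- w₀ ℤ.* k
    l₁ = c ℤ.- w₀ ℤ.- w₁ ℤ.* k
    remainder≢0 : ¬ (ℤ.- l₀ ≡ₚ 0ℤ × ℤ.- l₁ ≡ₚ 0ℤ)
    remainder≢0 (-l₀≡0 , -l₁≡0) = no-linear-factor k w₀ w₁
      (≡ₚ-trans (Modulo.x-y≡ₚ0⇒x≡ₚy p (-v≡ₚ0⇒v≡ₚ0 -l₀≡0)) (≡ₚ-reflexive (ℤ.*-comm w₀ k)))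
      (≡ₚ-trans (Modulo.x-y≡ₚ0⇒x≡ₚy p (≡ₚ-trans (≡ₚ-reflexive (reassoc c w₀ (w₁ ℤ.* k))) (-v≡ₚ0⇒v≡ₚ0 -l₁≡0))) (≡ₚ-reflexive (swap w₁ k w₀)))
      (≡ₚ-reflexive (b≡k+w₁ b w₁))
      where
      reassoc : ∀ c w₀ v → c ℤ.- (v ℤ.+ w₀) ≡ c ℤ.- w₀ ℤ.- v
      reassoc = ℤ-Solver.solve-∀
      swap : ∀ w₁ k w₀ → w₁ ℤ.* k ℤ.+ w₀ ≡ k ℤ.* w₁ ℤ.+ w₀
      swap = ℤ-Solver.solve-∀
      b≡k+w₁ : ∀ b w₁ → b ≡ (b ℤ.- w₁) ℤ.+ w₁
      b≡k+w₁ = ℤ-Solver.solve-∀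

  zero-or-unit : ∀ u → u ≈ 0# ⊎ Unit u
  zero-or-unit ⟨ u₀ , u₁ , u₂ ⟩ with ≡ₚ0? p-prime u₂
  ... | no u₂≢0 with inverse p-prime u₂ u₂≢0
  ...   | i , u₂i≡1 = inj₂ (unit-resp-≈ {u = ι u₂ * ⟨ u₀ ℤ.* i , u₁ ℤ.* i , 1ℤ ⟩}
                        (trans (scale-monic-quadratic u₂ (u₀ ℤ.* i) (u₁ ℤ.* i))
                               (componentwise (cancel-inverse u₂ i u₂i≡1 u₀) (cancel-inverse u₂ i u₂i≡1 u₁) ≡ₚ-refl))
                        (unit-* {u = ι u₂} (unit-scalar u₂≢0) (unit-monic-quadratic (u₀ ℤ.* i) (u₁ ℤ.* i))))
  zero-or-unit ⟨ u₀ , u₁ , u₂ ⟩ | yes u₂≡0 with ≡ₚ0? p-prime u₀ | ≡ₚ0? p-prime u₁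
  ... | yes u₀≡0 | yes u₁≡0 = inj₁ (componentwise u₀≡0 u₁≡0 u₂≡0)
  ... | no u₀≢0  | _         = inj₂ (unit-linear u₀ u₁ u₂ u₂≡0 (u₀≢0 ∘ proj₁))
  ... | _        | no u₁≢0   = inj₂ (unit-linear u₀ u₁ u₂ u₂≡0 (u₁≢0 ∘ proj₂))

  no-zero-divisors : ∀ u v → u * v ≈ 0# → u ≈ 0# ⊎ v ≈ 0#
  no-zero-divisors = zero-or-unit⇒no-zero-divisors zero-or-unit

  1≉0 : ¬ 1# ≈ 0#
  1≉0 1≈0 = Modulo.1≢ₚ0 p p-prime (ι-injective 1≈0)

  no-scalar-root : ∀ a → ¬ ι (d ℤ.+ a ℤ.* (c ℤ.+ a ℤ.* (b ℤ.+ a ℤ.* 1ℤ))) ≈ 0#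
  no-scalar-root a = no-root a ∘ ι-injective

open import Data.Nat using (ℕ; _≤_)
open import Data.Nat.Primality using (Prime)
open import Data.Integer using (ℤ; +_; _+_; _*_; _-_; 1ℤ)
open import Data.Integer.GCD using (gcd)
open import Data.List using ([]; _∷_)
open import Data.Product using (Σ; _×_)
open import Relation.Binary.PropositionalEquality using (_≡_)

theorem3 : (p : ℕ) → Prime p → 5 ≤ p → (b c d : ℤ) →
    gcd (b * b - + 3 * c) (+ p) ≡ 1ℤ →
    IrreducibleMod p (d ∷ c ∷ b ∷ 1ℤ ∷ []) →
    (c₀ c₁ c₂ : ℤ) →
    PolyCongMod p (d ∷ c ∷ b ∷ 1ℤ ∷ []) (X^ p) (c₀ ∷ c₁ ∷ c₂ ∷ []) →
    (Σ ℤ λ u → ModEq p (c₂ * u) 1ℤ) ×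
    ((t : ℤ) → ModEq p (t * c₂) (b * b - + 3 * c) →
      ModEq p (t * t)
        ((+ 18 * b * c * d - + 4 * b * b * b * d + b * b * c * c)
          - (+ 4 * c * c * c + + 27 * d * d)))
theorem3 p p-prime _ b c d gcd≡1 irreducible c₀ c₁ c₂ x^p≡g = c₂-invertible , t²≡discriminant
  where
  open Modulo p using (≡ₚ⇒ModEq; ModEq⇒≡ₚ; inverse; coprime⇒≢ₚ0)
  open CubicQuotient p b c d
  open CommutativeRing quotientRing using (_≈_; 0#; trans; sym) renaming (_*_ to _*ᵀ_)
  open CubicQuotientField p-prime b c d irreducible using (1≉0; no-zero-divisors; no-scalar-root)
  open IntegralDomain-over-ℤ/p p-prime quotientRing ι ι-isRingHomomorphism
  open CubicFrobeniusOrbit 1≉0 no-zero-divisors b c d no-scalar-root x x-root c₀ c₁ c₂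
    (sym (x^p≈g[x] (c₀ ∷ c₁ ∷ c₂ ∷ []) x^p≡g))

  c₂≉0 : ¬ ι c₂ ≈ 0#
  c₂≉0 = c₂-nonzero (coprime⇒≢ₚ0 p-prime gcd≡1 ∘ ι-injective)

  c₂-invertible : Σ ℤ λ u → ModEq p (c₂ * u) 1ℤ
  c₂-invertible = Product.map₂ ≡ₚ⇒ModEq (inverse p-prime c₂ (c₂≉0 ∘ ι-cong))

  t²≡discriminant : ∀ t → ModEq p (t * c₂) (b * b - + 3 * c) → ModEq p (t * t) (discriminantℤ b c d)
  t²≡discriminant t tc₂≡b²-3c = ≡ₚ⇒ModEq (ι-injective (trans (ι-* t t) (t²≈ι[discriminant] t tc₂≈K c₂≉0)))
    where
    tc₂≈K : ι t *ᵀ ι c₂ ≈ K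
    tc₂≈K = trans (sym (ι-* t c₂)) (trans (ι-cong (ModEq⇒≡ₚ {t * c₂} {b * b - + 3 * c} tc₂≡b²-3c)) (sym K≈ι[b²-3c]))
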